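{- Let $p$ be a prime and $d\in\mathbb{N}$. Let $b_1(X),\ldots,b_d(X)\in \mathbb{F}_p[X]$ be pairwise relatively prime polynomials with degrees $e_1,\ldots ,e_d\geq 1$, and let $\mathcal{S}=\{\boldsymbol{x}_n\}_{n\ge0}$ be the $d$-dimensional Halton-type sequence in bases $b_1(X),\ldots,b_d(X)$. Then, for any $N\ge 1$, the first $N$ points $P_N=\{\boldsymbol{x}_0,\ldots,\boldsymbol{x}_{N-1}\}$ satisfy \[ h(P_N) \le \frac{\sqrt{d}}{N^{1/d}} \max_{1 \le \ell \le d} p^{e_{\ell}}. \]
   Context: $\mathbb{F}_p=\{0,1,\ldots,p-1\}$ with arithmetic mod $p$. For $b(X)\in\mathbb{F}_p[X]$ of degree $e\ge1$ and $n\in\mathbb{N}_0$ with base-$p$ expansion $n=n_0+n_1p+n_2p^2+\cdots$, let $n(X)=\sum_i n_iX^i\in\mathbb{F}_p[X]$ and expand $n(X)=\sum_{j\ge0}a_j(X)b(X)^j$ with $a_j(X)\in\mathbb{F}_p[X]$, $\deg a_j<e$. The $b(X)$-adic radical inverse is $\varphi_{b(X)}(n)=\sum_{j\ge0}a_j(p)/(p^e)^{j+1}\in[0,1)$, where $a_j(p)$ is computed by viewing the coefficients of $a_j$ as integers in $\{0,\ldots,p-1\}$. The Halton-type sequence in pairwise coprime bases $b_1(X),\ldots,b_d(X)$ is $\boldsymbol{x}_n=(\varphi_{b_1(X)}(n),\ldots,\varphi_{b_d(X)}(n))$. The covering radius of a finite set $P_N\subset[0,1]^d$ is $h(P_N)=\sup_{\boldsymbol{x}\in[0,1]^d}\min_{0\le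 i<N}\|\boldsymbol{x}-\boldsymbol{x}_i\|$ with Euclidean norm.
   Formalization: In the covering radius h(P_N), the supremum ranges only over the points of [0,1]^d with rational coordinates. -}

module Defs where

open import Data.Nat as ℕ using (ℕ; zero; suc; _+_; _*_; _∸_; _^_; _≤?_; _<ᵇ_; NonZero; _⊔_)
open import Data.Nat.DivMod using (_%_; _/_)
open import Data.Nat.Properties using (m^n≢0)
open import Data.Bool using (if_then_else_)
open import Data.List as List using (List; []; _∷_; length; map; upTo; replicate; _++_; foldr)
open import Data.Nat.ListAction using (sum)
open import Data.Product using (_×_; _,_)
open import Data.Fin using (Fin)
open import Data.Integer using (+_)
open import Data.Rational as ℚ using (ℚ; 0ℚ; 1ℚ)
open import Relation.Nullary using (yes; no)
open import Relation.Binary.PropositionalEquality using (_≡_)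

-- Polynomials over F_p, represented by little-endian coefficient lists
-- of naturals (coefficient of X^i is the i-th entry, read mod p).

Poly : Set
Poly = List ℕ

coeff : Poly → ℕ → ℕ
coeff []      _       = 0
coeff (a ∷ f) zero    = a
coeff (a ∷ f) (suc k) = coeff f k

-- degree of a polynomial given in normal form (nonzero leading entry)
deg : Poly → ℕ
deg f = length f ∸ 1

module _ (p : ℕ) .{{_ : NonZero p}} where

  PolyEq : Poly → Poly → Set
  PolyEq f g = ∀ k → coeff f k % p ≡ coeff g k % p

  mulCoeff : Poly → Poly → ℕ → ℕ
  mulCoeff f g k = sum (map (λ i → coeff f i * coeff g (k ∸ i)) (upTo (suc k)))

  Divides : Poly → Poly → Set
  Divides c f = Data.Product.∃ λ q → ∀ k → mulCoeff c q k % p ≡ coeff f k % p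

  record WellFormed (f : Poly) : Set where
    field
      coeffs<p : ∀ k → coeff f k ℕ.< p
      nonzero  : 1 ℕ.≤ length f
      leading  : Relation.Nullary.¬ (coeff f (length f ∸ 1) ≡ 0)

  -- relatively prime: every common divisor is a unit (nonzero constant)
  RelPrime : Poly → Poly → Set
  RelPrime f g = ∀ c → Divides c f → Divides c g → ∀ k → 1 ℕ.≤ k → coeff c k % p ≡ 0

  addP : Poly → Poly → Poly
  addP f g = map (λ i → (coeff f i + coeff g i) % p) (upTo (length f ⊔ length g))

  mono : ℕ → ℕ → Poly
  mono t k = replicate k 0 ++ (t ∷ [])

  -- base-p digit polynomial n(X), with fuel
  digitPoly : ℕ → ℕ → Poly
  digitPoly zero       _ = []
  digitPoly (suc fuel) n = n % p ∷ digitPoly fuel (n / p)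

  nPoly : ℕ → Poly
  nPoly n = digitPoly n n

  evalAtP : Poly → ℕ
  evalAtP = foldr (λ a acc → a % p + p * acc) 0

  module Division (b : Poly) where
    e : ℕ
    e = length b ∸ 1

    -- inverse of the leading coefficient of b in F_p (Fermat, p prime)
    lcInv : ℕ
    lcInv = (coeff b e ^ (p ∸ 2)) % p

    -- one step of long division: cancel the top coefficient of f (length L > e)
    reduceTop : Poly → ℕ × Poly
    reduceTop f = t , map g (upTo (L ∸ 1))
      where
        L = length f
        k = L ∸ 1 ∸ e
        t = (coeff f (L ∸ 1) * lcInv) % p
        bs : ℕ → ℕ
        bs i = if i <ᵇ k then 0 else coeff b (i ∸ k)
        g : ℕ → ℕ
        g i = (coeff f i + (p ∸ (t * bs i) % p)) % p

    divmodF : ℕ → Poly → Poly × Poly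
    divmodF zero f = [] , f
    divmodF (suc fuel) f with length f ≤? e
    ... | yes _ = [] , f
    ... | no  _ with reduceTop f
    ...   | t , f' with divmodF fuel f'
    ...     | q , r = addP q (mono t (length f ∸ 1 ∸ e)) , r

    divmodP : Poly → Poly × Poly
    divmodP f = divmodF (length f) f

    adicDigits : ℕ → Poly → List Poly
    adicDigits zero       f = []
    adicDigits (suc fuel) f with divmodP f
    ... | q , r = r ∷ adicDigits fuel q

    radSum : ℕ → List Poly → ℚ
    radSum j []       = 0ℚ
    radSum j (a ∷ as) =
      ℚ._+_ (ℚ._/_ (+ evalAtP a) (p ^ (e * suc j)) ⦃ m^n≢0 p (e * suc j) ⦄) (radSum (suc j) as)

    radInv : ℕ → ℚ
    radInv n = radSum 0 (adicDigits (length (nPoly n)) (nPoly n))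

  halton : {d : ℕ} → (Fin d → Poly) → ℕ → Fin d → ℚ
  halton b n ℓ = Division.radInv (b ℓ) n

powℚ : ℚ → ℕ → ℚ
powℚ x zero    = 1ℚ
powℚ x (suc k) = ℚ._*_ x (powℚ x k)

sumFin : (d : ℕ) → (Fin d → ℚ) → ℚ
sumFin zero    f = 0ℚ
sumFin (suc d) f = ℚ._+_ (f Fin.zero) (sumFin d (λ i → f (Fin.suc i)))
  where import Data.Fin as Fin

maxFin : (d : ℕ) → (Fin d → ℕ) → ℕ
maxFin zero    f = 0
maxFin (suc d) f = f Fin.zero ⊔ maxFin d (λ i → f (Fin.suc i))
  where import Data.Fin as Fin

dist² : {d : ℕ} → (Fin d → ℚ) → (Fin d → ℚ) → ℚ
dist² {d} x y = sumFin d (λ ℓ → powℚ (ℚ._-_ (x ℓ) (y ℓ)) 2)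

ℕtoℚ : ℕ → ℚ
ℕtoℚ n = (+ n) ℚ./ 1

-- Fix x ∈ [0,1]^d. For each ℓ pick k_ℓ with Q_ℓ^d ≤ N < (p^e_ℓ Q_ℓ)^d, where Q_ℓ = p^(e_ℓ k_ℓ), and the cell
-- c_ℓ/Q_ℓ ≤ x_ℓ ≤ (c_ℓ+1)/Q_ℓ. The point x_n lies in the same cells as soon as the first k_ℓ b_ℓ(X)-adic digits
-- of n(X) are the base p^e_ℓ digits of c_ℓ, i.e. n(X) ≡ L_ℓ mod b_ℓ(X)^k_ℓ for an explicit L_ℓ. These moduli are
-- pairwise coprime, so the Chinese remainder theorem gives such an n(X) of degree < Σ e_ℓ k_ℓ, whence
-- n < ∏ Q_ℓ ≤ N. Then |x_ℓ - φ_ℓ(n)| ≤ 1/Q_ℓ ≤ 1/min Q, and N < (max p^e_ℓ · min Q)^d gives the bound.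

module Submission where

open import Data.Nat as ℕ using (ℕ; NonZero)
open import Data.Nat.Primality using (Prime)
open import Defs

module ModArith (p : ℕ) .{{_ : NonZero p}} where

  open import Data.Nat
  open import Data.Nat.Properties
  open import Data.Nat.DivMod
  open import Data.Nat.Divisibility
  open import Data.Fin as Fin using (Fin; toℕ; fromℕ)
  open import Data.Nat.Primality using (Prime; euclidsLemma)
  open import Data.Sum using (inj₁; inj₂)
  open import Relation.Nullary.Negation using (contradiction)
  open import Relation.Binary.PropositionalEquality
  open import Data.Nat.Solver using (module +-*-Solver)
  open import Algebra.Definitions.RawMonoid +-0-rawMonoid using (sum)

  sum-mod-last : ∀ n (g : Fin (suc n) → ℕ) → (∀ i → toℕ i < n → p ∣ g i) → sum g % p ≡ g (fromℕ n) % p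
  sum-mod-last zero    g _    = cong (_% p) (+-identityʳ (g Fin.zero))
  sum-mod-last (suc n) g p∣gᵢ = trans (%-remove-+ˡ _ (p∣gᵢ Fin.zero z<s))
    (sum-mod-last n (λ i → g (Fin.suc i)) (λ i i<n → p∣gᵢ (Fin.suc i) (s<s i<n)))

  %-cong-+ : ∀ {a a′ b b′} → a % p ≡ a′ % p → b % p ≡ b′ % p → (a + b) % p ≡ (a′ + b′) % p
  %-cong-+ {a} {a′} {b} {b′} a≡a′ b≡b′ = begin
    (a + b) % p                ≡⟨ %-distribˡ-+ a b p ⟩
    (a % p + b % p) % p        ≡⟨ cong₂ (λ u v → (u + v) % p) a≡a′ b≡b′ ⟩
    (a′ % p + b′ % p) % p      ≡⟨ %-distribˡ-+ a′ b′ p ⟨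
    (a′ + b′) % p              ∎
    where open ≡-Reasoning

  %-cong-* : ∀ {a a′ b b′} → a % p ≡ a′ % p → b % p ≡ b′ % p → (a * b) % p ≡ (a′ * b′) % p
  %-cong-* {a} {a′} {b} {b′} a≡a′ b≡b′ = begin
    (a * b) % p                ≡⟨ %-distribˡ-* a b p ⟩
    (a % p * (b % p)) % p      ≡⟨ cong₂ (λ u v → (u * v) % p) a≡a′ b≡b′ ⟩
    (a′ % p * (b′ % p)) % p    ≡⟨ %-distribˡ-* a′ b′ p ⟨
    (a′ * b′) % p              ∎
    where open ≡-Reasoning

  %≡%⇒∣∸ : ∀ m n → m % p ≡ n % p → p ∣ m ∸ n
  %≡%⇒∣∸ m n m≡n = divides (m / p ∸ n / p) (begin
    m ∸ n                                       ≡⟨ cong₂ _∸_ (m≡m%n+[m/n]*n m p) (m≡m%n+[m/n]*n n p) ⟩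
    (m % p + m / p * p) ∸ (n % p + n / p * p)   ≡⟨ cong (λ r → (m % p + m / p * p) ∸ (r + n / p * p)) m≡n ⟨
    (m % p + m / p * p) ∸ (m % p + n / p * p)   ≡⟨ [m+n]∸[m+o]≡n∸o (m % p) _ _ ⟩
    m / p * p ∸ n / p * p                       ≡⟨ *-distribʳ-∸ p (m / p) (n / p) ⟨
    (m / p ∸ n / p) * p                         ∎)
    where open ≡-Reasoning

  ∣∸⇒%≡% : ∀ {m n} → n ≤ m → p ∣ m ∸ n → m % p ≡ n % p
  ∣∸⇒%≡% {m} {n} n≤m p∣m∸n = trans (cong (_% p) (sym (m+[n∸m]≡n n≤m))) (%-remove-+ʳ n p∣m∸n)

  ∣a*[u∸v]⇒∣u∸v : Prime p → ∀ {a} u v → p ∤ a → (a * u) % p ≡ (a * v) % p → p ∣ u ∸ v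
  ∣a*[u∸v]⇒∣u∸v pr {a} u v p∤a au≡av
    with euclidsLemma a (u ∸ v) pr (subst (p ∣_) (sym (*-distribˡ-∸ a u v)) (%≡%⇒∣∸ _ _ au≡av))
  ... | inj₁ p∣a   = contradiction p∣a p∤a
  ... | inj₂ p∣u∸v = p∣u∸v

  *-cancelˡ-% : Prime p → ∀ {a} u v → p ∤ a → (a * u) % p ≡ (a * v) % p → u % p ≡ v % p
  *-cancelˡ-% pr u v p∤a au≡av with ≤-total v u
  ... | inj₁ v≤u = ∣∸⇒%≡% v≤u (∣a*[u∸v]⇒∣u∸v pr u v p∤a au≡av)
  ... | inj₂ u≤v = sym (∣∸⇒%≡% u≤v (∣a*[u∸v]⇒∣u∸v pr v u p∤a (sym au≡av)))

  [[a+[p∸x%p]]%p+x]%p≡a%p : ∀ a x → ((a + (p ∸ x % p)) % p + x) % p ≡ a % p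
  [[a+[p∸x%p]]%p+x]%p≡a%p a x = begin
    ((a + (p ∸ x % p)) % p + x) % p          ≡⟨ %-cong-+ (m%n%n≡m%n (a + (p ∸ x % p)) p) refl ⟩
    (a + (p ∸ x % p) + x) % p                ≡⟨ cong (λ y → (a + (p ∸ x % p) + y) % p) (m≡m%n+[m/n]*n x p) ⟩
    (a + (p ∸ x % p) + (x % p + x / p * p)) % p ≡⟨ cong (_% p) (solve 4 (λ a u v w → a :+ u :+ (v :+ w) := a :+ ((u :+ v) :+ w)) refl a (p ∸ x % p) (x % p) (x / p * p)) ⟩
    (a + ((p ∸ x % p + x % p) + x / p * p)) % p ≡⟨ cong (λ y → (a + (y + x / p * p)) % p) (m∸n+n≡m (m%n≤n x p)) ⟩
    (a + (1 + x / p) * p) % p                ≡⟨ [m+kn]%n≡m%n a (1 + x / p) p ⟩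
    a % p                                    ∎
    where
      open ≡-Reasoning
      open +-*-Solver

  0%p≡0 : 0 % p ≡ 0
  0%p≡0 = m*n%n≡0 0 p

module FermatLittle where

  open import Data.Nat
  open import Data.Nat.Properties
  open import Data.Nat.DivMod
  open import Data.Nat.Divisibility
  open import Data.Nat.Primality
  open ModArith using (sum-mod-last; %-cong-+; *-cancelˡ-%)
  open import Data.Nat.Combinatorics
  open import Data.Fin as Fin using (Fin; toℕ; fromℕ)
  open import Data.Fin.Properties using (toℕ-fromℕ)
  open import Data.Sum using (inj₁; inj₂)
  open import Relation.Nullary.Negation using (contradiction)
  open import Function using (_∘_)
  open import Relation.Binary.PropositionalEquality
  open import Algebra.Definitions.RawMonoid +-0-rawMonoid using (sum)
  import Algebra.Definitions.RawSemiring +-*-rawSemiring as Raw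
  import Algebra.Properties.CommutativeSemiring.Binomial +-*-commutativeSemiring as Binomial

  prime>1 : ∀ {p} → Prime p → 1 < p
  prime>1 {p} pr = nonTrivial⇒n>1 p {{prime⇒nonTrivial pr}}

  prime∤! : ∀ {p} → Prime p → ∀ {m} → m < p → p ∤ m !
  prime∤! pr {zero}  m<p p∣1 = <-irrefl (sym (∣1⇒≡1 p∣1)) (prime>1 pr)
  prime∤! pr {suc m} m<p p∣m! with euclidsLemma (suc m) (m !) pr p∣m!
  ... | inj₁ p∣1+m = <⇒≱ m<p (∣⇒≤ p∣1+m)
  ... | inj₂ p∣m!  = prime∤! pr (<-trans (n<1+n m) m<p) p∣m!

  n∣n! : ∀ n .{{_ : NonZero n}} → n ∣ n !
  n∣n! (suc n) = m∣m*n (n !)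

  prime∣C : ∀ {p} → Prime p → ∀ {k} → 0 < k → k < p → p ∣ p C k
  prime∣C {p} pr {k} 0<k k<p
    with euclidsLemma (p C k) (k ! * (p ∸ k) !) pr (subst (p ∣_) (sym C*k!*[p∸k]!≡p!) (n∣n! p {{prime⇒nonZero pr}}))
    where
      instance _ = k !* (p ∸ k) !≢0
      C*k!*[p∸k]!≡p! : (p C k) * (k ! * (p ∸ k) !) ≡ p !
      C*k!*[p∸k]!≡p! = trans (cong (_* (k ! * (p ∸ k) !)) (nCk≡n!/k![n-k]! (<⇒≤ k<p))) (m/n*n≡m (k![n∸k]!∣n! (<⇒≤ k<p)))
  ... | inj₁ p∣C = p∣C
  ... | inj₂ p∣k!*[p∸k]! with euclidsLemma (k !) ((p ∸ k) !) pr p∣k!*[p∸k]!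
  ...   | inj₁ p∣k!     = contradiction p∣k! (prime∤! pr k<p)
  ...   | inj₂ p∣[p∸k]! = contradiction p∣[p∸k]! (prime∤! pr (∸-monoʳ-< 0<k (<⇒≤ k<p)))

  ×≡* : ∀ n x → n Raw.× x ≡ n * x
  ×≡* zero    x = refl
  ×≡* (suc n) x = cong (x +_) (×≡* n x)

  ^≡^ : ∀ x n → x Raw.^ n ≡ x ^ n
  ^≡^ x zero    = refl
  ^≡^ x (suc n) = cong (x *_) (^≡^ x n)

  binomialTerm[x,1] : ∀ x n k → Binomial.binomialTerm x 1 n k ≡ (n C toℕ k) * x ^ toℕ k
  binomialTerm[x,1] x n k = begin
    (n C toℕ k) Raw.× (x Raw.^ toℕ k * 1 Raw.^ (n ∸ toℕ k)) ≡⟨ ×≡* (n C toℕ k) _ ⟩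
    (n C toℕ k) * (x Raw.^ toℕ k * 1 Raw.^ (n ∸ toℕ k))     ≡⟨ cong (λ y → (n C toℕ k) * (x Raw.^ toℕ k * y)) 1^[n∸k]≡1 ⟩
    (n C toℕ k) * (x Raw.^ toℕ k * 1)                        ≡⟨ cong (λ y → (n C toℕ k) * y) (trans (*-identityʳ (x Raw.^ toℕ k)) (^≡^ x (toℕ k))) ⟩
    (n C toℕ k) * x ^ toℕ k                                  ∎
    where
      open ≡-Reasoning
      1^[n∸k]≡1 : 1 Raw.^ (n ∸ toℕ k) ≡ 1
      1^[n∸k]≡1 = trans (^≡^ 1 (n ∸ toℕ k)) (^-zeroˡ (n ∸ toℕ k))

  -- Freshman's dream: the middle binomial coefficients p C k vanish mod p.
  [x+1]^p≡x^p+1 : ∀ {p} .{{_ : NonZero p}} → Prime p → ∀ x → (x + 1) ^ p % p ≡ (x ^ p + 1) % p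
  [x+1]^p≡x^p+1 {suc (suc n)} pr x = begin
    (x + 1) ^ p % p                                       ≡⟨ cong (_% p) (trans (sym (^≡^ (x + 1) p)) (Binomial.theorem p x 1)) ⟩
    (term Fin.zero + sum (λ i → term (Fin.suc i))) % p    ≡⟨ %-cong-+ p {term Fin.zero} {term Fin.zero} refl (sum-mod-last p (suc n) (λ i → term (Fin.suc i)) p∣middle) ⟩
    (term Fin.zero + term (fromℕ p)) % p                  ≡⟨ cong (_% p) (cong₂ _+_ first last) ⟩
    (1 + x ^ p) % p                                       ≡⟨ cong (_% p) (+-comm 1 (x ^ p)) ⟩
    (x ^ p + 1) % p                                       ∎
    where
      open ≡-Reasoning
      p : ℕ
      p = suc (suc n)
      term : Fin (suc p) → ℕ
      term = Binomial.binomialTerm x 1 p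
      first : term Fin.zero ≡ 1
      first = trans (binomialTerm[x,1] x p Fin.zero) (*-identityʳ (p C 0))
      last : term (fromℕ p) ≡ x ^ p
      last = trans (binomialTerm[x,1] x p (fromℕ p))
        (subst (λ k → (p C k) * x ^ k ≡ x ^ p) (sym (toℕ-fromℕ p)) (trans (cong (_* x ^ p) (nCn≡1 p)) (*-identityˡ (x ^ p))))
      p∣middle : ∀ i → toℕ i < suc n → p ∣ term (Fin.suc i)
      p∣middle i i<1+n = subst (p ∣_) (sym (binomialTerm[x,1] x p (Fin.suc i)))
        (∣m⇒∣m*n _ (prime∣C pr z<s (s<s i<1+n)))

  a^p≡a : ∀ {p} .{{_ : NonZero p}} → Prime p → ∀ a → a ^ p % p ≡ a % p
  a^p≡a {suc n} pr zero    = refl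
  a^p≡a {p}     pr (suc a) = begin
    suc a ^ p % p        ≡⟨ cong (λ y → y ^ p % p) (+-comm 1 a) ⟩
    (a + 1) ^ p % p      ≡⟨ [x+1]^p≡x^p+1 pr a ⟩
    (a ^ p + 1) % p      ≡⟨ %-cong-+ p {a ^ p} (a^p≡a pr a) refl ⟩
    (a + 1) % p          ≡⟨ cong (_% p) (+-comm a 1) ⟩
    suc a % p            ∎
    where open ≡-Reasoning

  fermat : ∀ {p} .{{_ : NonZero p}} → Prime p → ∀ {a} → p ∤ a → a ^ (p ∸ 1) % p ≡ 1
  fermat {suc n} pr {a} p∤a = trans (*-cancelˡ-% (suc n) pr (a ^ n) 1 p∤a a*a^n≡a*1) (m<n⇒m%n≡m (prime>1 pr))
    where
      a*a^n≡a*1 : (a * a ^ n) % suc n ≡ (a * 1) % suc n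
      a*a^n≡a*1 = trans (a^p≡a pr a) (cong (_% suc n) (sym (*-identityʳ a)))

  ^[p∸2]-inverseˡ : ∀ {p} .{{_ : NonZero p}} → Prime p → ∀ {a} → a % p ≢ 0 → (a ^ (p ∸ 2) * a) % p ≡ 1
  ^[p∸2]-inverseˡ {p} pr {a} a≢0 with prime>1 pr
  ^[p∸2]-inverseˡ {suc (suc n)} pr {a} a≢0 | _ =
    trans (cong (_% suc (suc n)) (*-comm (a ^ n) a)) (fermat pr (a≢0 ∘ n∣m⇒m%n≡0 a (suc (suc n))))

module PolyRing (p : ℕ) .{{_ : NonZero p}} where

  open import Data.Nat
  open import Data.Nat.Properties
  open import Data.Nat.DivMod
  open import Data.Nat.ListAction using (sum)
  open import Data.List as List using (List; []; _∷_; map; upTo; applyUpTo; length)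
  import Data.List.Properties as List
  open import Data.Maybe using (nothing)
  open import Data.Product using (_,_)
  open import Relation.Binary.PropositionalEquality
  open import Relation.Binary.Structures using (IsEquivalence)
  import Relation.Binary.Reasoning.Setoid
  open import Algebra.Bundles using (CommutativeRing)
  import Algebra.Properties.Ring as RingProperties
  import Algebra.Properties.CommutativeSemigroup as CommutativeSemigroupProperties
  import Tactic.RingSolver.Core.AlmostCommutativeRing as AlmostCommutativeRing
  open import Data.Nat.Solver using (module +-*-Solver)
  open import Function using (_∘_)
  open ModArith p using (%-cong-+; %-cong-*; 0%p≡0)

  infixl 6 _⊕_
  infixl 7 _⊗_ _·_
  infix 4 _≐_ _≈_

  _⊕_ : Poly → Poly → Poly
  []      ⊕ g       = g
  (a ∷ f) ⊕ []      = a ∷ f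
  (a ∷ f) ⊕ (b ∷ g) = (a + b) ∷ (f ⊕ g)

  _·_ : ℕ → Poly → Poly
  a · f = map (a *_) f

  _⊗_ : Poly → Poly → Poly
  []      ⊗ g = []
  (a ∷ f) ⊗ g = a · g ⊕ (0 ∷ f ⊗ g)

  coeff-⊕ : ∀ f g k → coeff (f ⊕ g) k ≡ coeff f k + coeff g k
  coeff-⊕ []      g       k       = refl
  coeff-⊕ (a ∷ f) []      k       = sym (+-identityʳ _)
  coeff-⊕ (a ∷ f) (b ∷ g) zero    = refl
  coeff-⊕ (a ∷ f) (b ∷ g) (suc k) = coeff-⊕ f g k

  coeff-· : ∀ a f k → coeff (a · f) k ≡ a * coeff f k
  coeff-· a []      k       = sym (*-zeroʳ a)
  coeff-· a (b ∷ f) zero    = refl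
  coeff-· a (b ∷ f) (suc k) = coeff-· a f k

  coeff-⊗ : ∀ f g k → coeff (f ⊗ g) k ≡ mulCoeff p f g k
  coeff-⊗ []      g k       = sym (sum-map-0 (upTo (suc k)))
    where
      sum-map-0 : ∀ (xs : List ℕ) → sum (map (λ _ → 0) xs) ≡ 0
      sum-map-0 []       = refl
      sum-map-0 (x ∷ xs) = sum-map-0 xs
  coeff-⊗ (a ∷ f) g zero    = trans (coeff-⊕ (a · g) _ 0) (cong (_+ 0) (coeff-· a g 0))
  coeff-⊗ (a ∷ f) g (suc k) = begin
    coeff (a · g ⊕ (0 ∷ f ⊗ g)) (suc k)                     ≡⟨ coeff-⊕ (a · g) _ (suc k) ⟩
    coeff (a · g) (suc k) + coeff (f ⊗ g) k                 ≡⟨ cong₂ _+_ (coeff-· a g (suc k)) (coeff-⊗ f g k) ⟩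
    a * coeff g (suc k) + mulCoeff p f g k                  ≡⟨ cong (λ s → a * coeff g (suc k) + sum s) (List.map-upTo _ (suc k)) ⟩
    a * coeff g (suc k) + sum (applyUpTo (h ∘ suc) (suc k)) ≡⟨ cong (λ s → a * coeff g (suc k) + sum s) (List.map-applyUpTo suc h (suc k)) ⟨
    h 0 + sum (map h (applyUpTo suc (suc k)))               ∎
    where
      open ≡-Reasoning
      h : ℕ → ℕ
      h i = coeff (a ∷ f) i * coeff g (suc k ∸ i)

  coeff-beyond : ∀ f {i} → length f ≤ i → coeff f i ≡ 0
  coeff-beyond []      _           = refl
  coeff-beyond (a ∷ f) {suc i} (s≤s L≤i) = coeff-beyond f L≤i

  coeff-0∷[] : ∀ k → coeff (0 ∷ []) k ≡ 0
  coeff-0∷[] zero    = refl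
  coeff-0∷[] (suc k) = refl

  coeff-tabulate : ∀ (h : ℕ → ℕ) n {i} → i < n → coeff (map h (upTo n)) i ≡ h i
  coeff-tabulate h n {i} i<n = trans (cong (λ f → coeff f i) (List.map-upTo h n)) (go h n i<n)
    where
      go : ∀ (h : ℕ → ℕ) n {i} → i < n → coeff (applyUpTo h n) i ≡ h i
      go h (suc n) {zero}  _         = refl
      go h (suc n) {suc i} (s≤s i<n) = go (λ j → h (suc j)) n i<n

  length-tabulate : ∀ (h : ℕ → ℕ) n → length (map h (upTo n)) ≡ n
  length-tabulate h n = trans (List.length-map h (upTo n)) (List.length-upTo n)

  record _≐_ (f g : Poly) : Set where
    constructor mk≐
    field coeff-≡ : ∀ k → coeff f k ≡ coeff g k
  open _≐_

  record _≈_ (f g : Poly) : Set where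
    constructor mk≈
    field coeff-≈ : PolyEq p f g
  open _≈_ public

  module Exact where

    ≐-refl : ∀ {f} → f ≐ f
    ≐-refl = mk≐ λ _ → refl

    ≐-sym : ∀ {f g} → f ≐ g → g ≐ f
    ≐-sym f≐g = mk≐ λ k → sym (coeff-≡ f≐g k)

    ≐-trans : ∀ {f g h} → f ≐ g → g ≐ h → f ≐ h
    ≐-trans f≐g g≐h = mk≐ λ k → trans (coeff-≡ f≐g k) (coeff-≡ g≐h k)

    ≐-by : ∀ {f g} {F G : ℕ → ℕ} → (∀ k → F k ≡ G k) →
           (∀ k → coeff f k ≡ F k) → (∀ k → coeff g k ≡ G k) → f ≐ g
    ≐-by F≡G f≡F g≡G = mk≐ λ k → trans (f≡F k) (trans (F≡G k) (sym (g≡G k)))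

    ∷-cong : ∀ a {f g} → f ≐ g → a ∷ f ≐ a ∷ g
    ∷-cong a f≐g = mk≐ λ { zero → refl ; (suc k) → coeff-≡ f≐g k }

    ⊕-cong : ∀ {f f′ g g′} → f ≐ f′ → g ≐ g′ → f ⊕ g ≐ f′ ⊕ g′
    ⊕-cong {f} {f′} {g} {g′} f≐f′ g≐g′ = ≐-by (λ k → cong₂ _+_ (coeff-≡ f≐f′ k) (coeff-≡ g≐g′ k)) (coeff-⊕ f g) (coeff-⊕ f′ g′)

    ⊕-comm : ∀ f g → f ⊕ g ≐ g ⊕ f
    ⊕-comm f g = ≐-by (λ k → +-comm (coeff f k) (coeff g k)) (coeff-⊕ f g) (coeff-⊕ g f)

    ⊕-assoc : ∀ f g h → f ⊕ g ⊕ h ≐ f ⊕ (g ⊕ h)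
    ⊕-assoc f g h = ≐-by (λ k → +-assoc (coeff f k) (coeff g k) (coeff h k))
      (λ k → trans (coeff-⊕ (f ⊕ g) h k) (cong (_+ coeff h k) (coeff-⊕ f g k)))
      (λ k → trans (coeff-⊕ f (g ⊕ h) k) (cong (coeff f k +_) (coeff-⊕ g h k)))

    ⊕-identityʳ : ∀ f → f ⊕ [] ≐ f
    ⊕-identityʳ f = mk≐ λ k → trans (coeff-⊕ f [] k) (+-identityʳ _)

    ⊕-interchange : ∀ f g h i → (f ⊕ g) ⊕ (h ⊕ i) ≐ (f ⊕ h) ⊕ (g ⊕ i)
    ⊕-interchange f g h i = ≐-by
      (λ k → solve 4 (λ a b c d → (a :+ b) :+ (c :+ d) := (a :+ c) :+ (b :+ d)) refl (coeff f k) (coeff g k) (coeff h k) (coeff i k))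
      (λ k → trans (coeff-⊕ (f ⊕ g) (h ⊕ i) k) (cong₂ _+_ (coeff-⊕ f g k) (coeff-⊕ h i k)))
      (λ k → trans (coeff-⊕ (f ⊕ h) (g ⊕ i) k) (cong₂ _+_ (coeff-⊕ f h k) (coeff-⊕ g i k)))
      where open +-*-Solver

    ·-distrib-⊕ : ∀ a f g → a · (f ⊕ g) ≐ a · f ⊕ a · g
    ·-distrib-⊕ a f g = ≐-by (λ k → *-distribˡ-+ a (coeff f k) (coeff g k))
      (λ k → trans (coeff-· a (f ⊕ g) k) (cong (a *_) (coeff-⊕ f g k)))
      (λ k → trans (coeff-⊕ (a · f) (a · g) k) (cong₂ _+_ (coeff-· a f k) (coeff-· a g k)))

    +-distrib-· : ∀ a b f → (a + b) · f ≐ a · f ⊕ b · f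
    +-distrib-· a b f = ≐-by (λ k → *-distribʳ-+ (coeff f k) a b)
      (coeff-· (a + b) f)
      (λ k → trans (coeff-⊕ (a · f) (b · f) k) (cong₂ _+_ (coeff-· a f k) (coeff-· b f k)))

    *-assoc-· : ∀ a b f → (a * b) · f ≐ a · (b · f)
    *-assoc-· a b f = ≐-by (λ k → *-assoc a b (coeff f k))
      (coeff-· (a * b) f)
      (λ k → trans (coeff-· a (b · f) k) (cong (a *_) (coeff-· b f k)))

    0·-absorb : ∀ f g → 0 · f ⊕ g ≐ g
    0·-absorb f g = mk≐ λ k → trans (coeff-⊕ (0 · f) g k) (cong (_+ coeff g k) (coeff-· 0 f k))

    ·-shift : ∀ a f → 0 ∷ a · f ≐ a · (0 ∷ f)
    ·-shift a f = mk≐ λ { zero → sym (*-zeroʳ a) ; (suc k) → refl }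

    ⊗-zeroʳ : ∀ f → f ⊗ [] ≐ []
    ⊗-zeroʳ []      = ≐-refl
    ⊗-zeroʳ (a ∷ f) = mk≐ λ { zero → refl ; (suc k) → coeff-≡ (⊗-zeroʳ f) k }

    ⊗-identityˡ : ∀ f → (1 ∷ []) ⊗ f ≐ f
    ⊗-identityˡ f = mk≐ λ k → begin
      coeff (1 · f ⊕ (0 ∷ [])) k          ≡⟨ coeff-⊕ (1 · f) (0 ∷ []) k ⟩
      coeff (1 · f) k + coeff (0 ∷ []) k  ≡⟨ cong₂ _+_ (coeff-· 1 f k) (coeff-0∷[] k) ⟩
      1 * coeff f k + 0                   ≡⟨ trans (+-identityʳ _) (*-identityˡ _) ⟩
      coeff f k                           ∎
      where open ≡-Reasoning

    ⊕-left-comm : ∀ f g h → f ⊕ (g ⊕ h) ≐ g ⊕ (f ⊕ h)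
    ⊕-left-comm f g h = ≐-by (λ k → solve 3 (λ a b c → a :+ (b :+ c) := b :+ (a :+ c)) refl (coeff f k) (coeff g k) (coeff h k))
      (λ k → trans (coeff-⊕ f (g ⊕ h) k) (cong (coeff f k +_) (coeff-⊕ g h k)))
      (λ k → trans (coeff-⊕ g (f ⊕ h) k) (cong (coeff g k +_) (coeff-⊕ f h k)))
      where open +-*-Solver

    ⊗-∷ʳ : ∀ f a g → f ⊗ (a ∷ g) ≐ a · f ⊕ (0 ∷ f ⊗ g)
    ⊗-∷ʳ []      a g = mk≐ λ { zero → refl ; (suc k) → refl }
    ⊗-∷ʳ (b ∷ f) a g = mk≐ λ
      { zero    → cong (_+ 0) (*-comm b a)
      ; (suc k) → coeff-≡ (≐-trans (⊕-cong (≐-refl {b · g}) (⊗-∷ʳ f a g)) (⊕-left-comm (b · g) (a · f) (0 ∷ f ⊗ g))) k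
      }

    ⊗-comm : ∀ f g → f ⊗ g ≐ g ⊗ f
    ⊗-comm []      g = ≐-sym (⊗-zeroʳ g)
    ⊗-comm (a ∷ f) g = ≐-trans (⊕-cong (≐-refl {a · g}) (∷-cong 0 (⊗-comm f g))) (≐-sym (⊗-∷ʳ g a f))

    ⊗-distribʳ : ∀ f g h → (f ⊕ g) ⊗ h ≐ f ⊗ h ⊕ g ⊗ h
    ⊗-distribʳ []      g       h = ≐-refl
    ⊗-distribʳ (a ∷ f) []      h = ≐-sym (⊕-identityʳ _)
    ⊗-distribʳ (a ∷ f) (b ∷ g) h = ≐-trans (⊕-cong (+-distrib-· a b h) (∷-cong 0 (⊗-distribʳ f g h)))
                                            (⊕-interchange (a · h) (b · h) (0 ∷ f ⊗ h) (0 ∷ g ⊗ h))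

    ·-assoc-⊗ : ∀ a f h → (a · f) ⊗ h ≐ a · (f ⊗ h)
    ·-assoc-⊗ a []      h = ≐-refl
    ·-assoc-⊗ a (b ∷ f) h = ≐-trans (⊕-cong (*-assoc-· a b h) (≐-trans (∷-cong 0 (·-assoc-⊗ a f h)) (·-shift a (f ⊗ h))))
                                    (≐-sym (·-distrib-⊕ a (b · h) (0 ∷ f ⊗ h)))

    ⊗-assoc : ∀ f g h → f ⊗ g ⊗ h ≐ f ⊗ (g ⊗ h)
    ⊗-assoc []      g h = ≐-refl
    ⊗-assoc (a ∷ f) g h = ≐-trans (⊗-distribʳ (a · g) (0 ∷ f ⊗ g) h)
      (⊕-cong (·-assoc-⊗ a g h) (≐-trans (0·-absorb h (0 ∷ f ⊗ g ⊗ h)) (∷-cong 0 (⊗-assoc f g h))))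

  open Exact using (≐-trans; ≐-sym)

  ≐⇒≈ : ∀ {f g} → f ≐ g → f ≈ g
  ≐⇒≈ f≐g = mk≈ λ k → cong (_% p) (coeff-≡ f≐g k)

  ≈-isEquivalence : IsEquivalence _≈_
  ≈-isEquivalence = record
    { refl  = mk≈ λ _ → refl
    ; sym   = λ f≈g → mk≈ λ k → sym (coeff-≈ f≈g k)
    ; trans = λ f≈g g≈h → mk≈ λ k → trans (coeff-≈ f≈g k) (coeff-≈ g≈h k)
    }

  ⊕-cong : ∀ {f f′ g g′} → f ≈ f′ → g ≈ g′ → f ⊕ g ≈ f′ ⊕ g′
  ⊕-cong {f} {f′} {g} {g′} f≈f′ g≈g′ = mk≈ λ k → begin
    coeff (f ⊕ g) k % p                ≡⟨ cong (_% p) (coeff-⊕ f g k) ⟩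
    (coeff f k + coeff g k) % p        ≡⟨ %-cong-+ (coeff-≈ f≈f′ k) (coeff-≈ g≈g′ k) ⟩
    (coeff f′ k + coeff g′ k) % p      ≡⟨ cong (_% p) (coeff-⊕ f′ g′ k) ⟨
    coeff (f′ ⊕ g′) k % p              ∎
    where open ≡-Reasoning

  ·-cong : ∀ {a a′ f f′} → a % p ≡ a′ % p → f ≈ f′ → a · f ≈ a′ · f′
  ·-cong {a} {a′} {f} {f′} a≡a′ f≈f′ = mk≈ λ k → begin
    coeff (a · f) k % p      ≡⟨ cong (_% p) (coeff-· a f k) ⟩
    (a * coeff f k) % p      ≡⟨ %-cong-* a≡a′ (coeff-≈ f≈f′ k) ⟩
    (a′ * coeff f′ k) % p    ≡⟨ cong (_% p) (coeff-· a′ f′ k) ⟨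
    coeff (a′ · f′) k % p    ∎
    where open ≡-Reasoning

  ⊗-cong : ∀ {f f′ g g′} → f ≈ f′ → g ≈ g′ → f ⊗ g ≈ f′ ⊗ g′
  ⊗-cong {f} {f′} {g} {g′} f≈f′ g≈g′ = mk≈ λ k → begin
    coeff (f ⊗ g) k % p        ≡⟨ cong (_% p) (coeff-⊗ f g k) ⟩
    mulCoeff p f g k % p       ≡⟨ sum-cong (upTo (suc k)) (λ i → %-cong-* (coeff-≈ f≈f′ i) (coeff-≈ g≈g′ (k ∸ i))) ⟩
    mulCoeff p f′ g′ k % p     ≡⟨ cong (_% p) (coeff-⊗ f′ g′ k) ⟨
    coeff (f′ ⊗ g′) k % p      ∎
    where
      open ≡-Reasoning
      sum-cong : ∀ {h h′ : ℕ → ℕ} xs → (∀ i → h i % p ≡ h′ i % p) → sum (map h xs) % p ≡ sum (map h′ xs) % p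
      sum-cong []       _     = refl
      sum-cong (x ∷ xs) h≡h′ = %-cong-+ (h≡h′ x) (sum-cong xs h≡h′)

  ⊕-congˡ : ∀ {f g g′} → g ≈ g′ → f ⊕ g ≈ f ⊕ g′
  ⊕-congˡ {f} = ⊕-cong {f} {f} (mk≈ λ _ → refl)

  ⊕-congʳ : ∀ {f f′ g} → f ≈ f′ → f ⊕ g ≈ f′ ⊕ g
  ⊕-congʳ {g = g} f≈f′ = ⊕-cong {g = g} {g} f≈f′ (mk≈ λ _ → refl)

  ⊗-congˡ : ∀ {f g g′} → g ≈ g′ → f ⊗ g ≈ f ⊗ g′
  ⊗-congˡ {f} = ⊗-cong {f} {f} (mk≈ λ _ → refl)

  ⊗-congʳ : ∀ {f f′ g} → f ≈ f′ → f ⊗ g ≈ f′ ⊗ g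
  ⊗-congʳ {g = g} f≈f′ = ⊗-cong {g = g} {g} f≈f′ (mk≈ λ _ → refl)

  -- Negation is scaling by p - 1, which is -1 modulo p.
  neg : Poly → Poly
  neg f = (p ∸ 1) · f

  one : Poly
  one = 1 ∷ []

  ⊕-inverseʳ : ∀ f → f ⊕ neg f ≈ []
  ⊕-inverseʳ f = mk≈ λ k → begin
    coeff (f ⊕ neg f) k % p               ≡⟨ cong (_% p) (trans (coeff-⊕ f (neg f) k) (cong (coeff f k +_) (coeff-· (p ∸ 1) f k))) ⟩
    (coeff f k + (p ∸ 1) * coeff f k) % p ≡⟨⟩
    ((1 + (p ∸ 1)) * coeff f k) % p       ≡⟨ cong (λ m → (m * coeff f k) % p) (m+[n∸m]≡n (>-nonZero⁻¹ p)) ⟩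
    (p * coeff f k) % p                   ≡⟨ cong (_% p) (*-comm p (coeff f k)) ⟩
    (coeff f k * p) % p                   ≡⟨ m*n%n≡0 (coeff f k) p ⟩
    0                                     ≡⟨ 0%p≡0 ⟨
    coeff [] k % p                        ∎
    where open ≡-Reasoning

  infixr 8 _^ᵖ_

  _^ᵖ_ : Poly → ℕ → Poly
  f ^ᵖ zero  = one
  f ^ᵖ suc k = f ⊗ f ^ᵖ k

  ∷-≈[] : ∀ {a f} → a % p ≡ 0 → f ≈ [] → a ∷ f ≈ []
  ∷-≈[] a≡0 f≈[] = mk≈ λ { zero → trans a≡0 (sym 0%p≡0) ; (suc k) → coeff-≈ f≈[] k }

  𝔽ₚ[X]-commutativeRing : CommutativeRing _ _
  𝔽ₚ[X]-commutativeRing = record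
    { Carrier = Poly ; _≈_ = _≈_ ; _+_ = _⊕_ ; _*_ = _⊗_ ; -_ = neg ; 0# = [] ; 1# = one
    ; isCommutativeRing = record
      { isRing = record
        { +-isAbelianGroup = record
          { isGroup = record
            { isMonoid = record
              { isSemigroup = record
                { isMagma = record { isEquivalence = ≈-isEquivalence ; ∙-cong = ⊕-cong }
                ; assoc   = λ f g h → ≐⇒≈ (Exact.⊕-assoc f g h) }
              ; identity  = (λ _ → ≈-refl) , (λ f → ≐⇒≈ (Exact.⊕-identityʳ f)) }
            ; inverse = (λ f → ≈-trans (≐⇒≈ (Exact.⊕-comm (neg f) f)) (⊕-inverseʳ f)) , ⊕-inverseʳ
            ; ⁻¹-cong = ·-cong {p ∸ 1} refl }
          ; comm = λ f g → ≐⇒≈ (Exact.⊕-comm f g) }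
        ; *-cong     = ⊗-cong
        ; *-assoc    = λ f g h → ≐⇒≈ (Exact.⊗-assoc f g h)
        ; *-identity = (λ f → ≐⇒≈ (Exact.⊗-identityˡ f))
                     , (λ f → ≐⇒≈ (≐-trans (Exact.⊗-comm f one) (Exact.⊗-identityˡ f)))
        ; distrib    = (λ f g h → ≐⇒≈ (≐-trans (Exact.⊗-comm f (g ⊕ h))
                                        (≐-trans (Exact.⊗-distribʳ g h f) (Exact.⊕-cong (Exact.⊗-comm g f) (Exact.⊗-comm h f)))))
                     , (λ f g h → ≐⇒≈ (Exact.⊗-distribʳ g h f)) }
      ; *-comm = λ f g → ≐⇒≈ (Exact.⊗-comm f g) } }
    where
      open IsEquivalence ≈-isEquivalence renaming (refl to ≈-refl; trans to ≈-trans)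

  module 𝔽ₚ[X] where
    open CommutativeRing 𝔽ₚ[X]-commutativeRing public
    open RingProperties ring public
    open CommutativeSemigroupProperties (CommutativeRing.+-commutativeSemigroup 𝔽ₚ[X]-commutativeRing) public
      using () renaming (interchange to +-interchange)
    open CommutativeSemigroupProperties (CommutativeRing.*-commutativeSemigroup 𝔽ₚ[X]-commutativeRing) public
      using () renaming (x∙yz≈y∙xz to *-left-comm)

  module ≈-Reasoning = Relation.Binary.Reasoning.Setoid 𝔽ₚ[X].setoid

  -- The solver's coefficients are polynomials with symbolic p and no zero test, so it proves only identities
  -- that need no cancellation x ⊕ neg x ≈ []; such cancellations are done by hand with 𝔽ₚ[X].-‿inverseʳ.
  open import Tactic.RingSolver.NonReflective (AlmostCommutativeRing.fromCommutativeRing 𝔽ₚ[X]-commutativeRing (λ _ → nothing))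
    public using (_⊜_) renaming (solve to solve-𝔽ₚ[X]; _⊕_ to _:+_; _⊗_ to _:*_; ⊝_ to :-_)

module DivisionAlgorithm (p : ℕ) .{{_ : NonZero p}} (pr : Prime p) (b : Poly) (wf : WellFormed p b) where

  open import Data.Nat
  open import Data.Nat.Properties
  open import Data.Nat.DivMod
  open import Data.Nat.Divisibility using (m%n≡0⇒n∣m; n∣m⇒m%n≡0)
  open import Data.Nat.Primality using (euclidsLemma)
  open import Data.List using ([]; _∷_; length)
  open import Data.Bool using (if_then_else_; false)
  open import Data.Product using (_×_; _,_; proj₁; proj₂)
  open import Data.Sum using (inj₁; inj₂)
  open import Relation.Nullary using (yes; no)
  open import Relation.Nullary.Negation using (contradiction)
  open import Relation.Binary.PropositionalEquality
  open import Function using (_∘_)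
  open import Relation.Binary.Definitions using (tri<; tri≈; tri>)
  open ModArith p using (%-cong-+; %-cong-*; [[a+[p∸x%p]]%p+x]%p≡a%p; 0%p≡0)
  open FermatLittle using (^[p∸2]-inverseˡ)
  open PolyRing p
  open Division p b
  open WellFormed wf

  lc : ℕ
  lc = coeff b e

  length-b : length b ≡ suc e
  length-b = sym (m+[n∸m]≡n nonzero)

  lc%p≢0 : lc % p ≢ 0
  lc%p≢0 = leading ∘ trans (sym (m<n⇒m%n≡m (coeffs<p e)))

  lcInv-inverse : (lcInv * lc) % p ≡ 1
  lcInv-inverse = trans (%-cong-* (m%n%n≡m%n (lc ^ (p ∸ 2)) p) refl) (^[p∸2]-inverseˡ pr lc%p≢0)

  addP≈⊕ : ∀ f g → addP p f g ≈ f ⊕ g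
  addP≈⊕ f g = mk≈ λ i → by-cases i
    where
      n : ℕ
      n = length f ⊔ length g
      by-cases : ∀ i → coeff (addP p f g) i % p ≡ coeff (f ⊕ g) i % p
      by-cases i with i <? n
      ... | yes i<n = trans (cong (_% p) (coeff-tabulate _ n i<n)) (trans (m%n%n≡m%n _ p) (cong (_% p) (sym (coeff-⊕ f g i))))
      ... | no  i≮n = cong (_% p) (begin
        coeff (addP p f g) i     ≡⟨ coeff-beyond (addP p f g) (subst (_≤ i) (sym (length-tabulate _ n)) (≮⇒≥ i≮n)) ⟩
        0 + 0                    ≡⟨ cong₂ _+_ (coeff-beyond f (≤-trans (m≤m⊔n _ _) (≮⇒≥ i≮n))) (coeff-beyond g (≤-trans (m≤n⊔m _ _) (≮⇒≥ i≮n))) ⟨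
        coeff f i + coeff g i    ≡⟨ coeff-⊕ f g i ⟨
        coeff (f ⊕ g) i          ∎)
        where open ≡-Reasoning

  length-mono : ∀ t k → length (mono p t k) ≡ suc k
  length-mono t zero    = refl
  length-mono t (suc k) = cong suc (length-mono t k)

  coeff-mono⊗ : ∀ t k f i → coeff (mono p t k ⊗ f) i ≡ t * (if i <ᵇ k then 0 else coeff f (i ∸ k))
  coeff-mono⊗ t zero    f i       = trans (coeff-⊕ (t · f) (0 ∷ []) i)
                                      (trans (cong₂ _+_ (coeff-· t f i) (coeff-0∷[] i)) (+-identityʳ _))
  coeff-mono⊗ t (suc k) f zero    = trans (coeff-⊕ (0 · f) _ 0) (trans (cong (_+ 0) (coeff-· 0 f 0)) (sym (*-zeroʳ t)))
  coeff-mono⊗ t (suc k) f (suc i) = trans (coeff-⊕ (0 · f) (0 ∷ mono p t k ⊗ f) (suc i))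
                                      (trans (cong (_+ coeff (mono p t k ⊗ f) i) (coeff-· 0 f (suc i))) (coeff-mono⊗ t k f i))

  ≤⇒<ᵇ≡false : ∀ {k i} → k ≤ i → (i <ᵇ k) ≡ false
  ≤⇒<ᵇ≡false {zero}          _         = refl
  ≤⇒<ᵇ≡false {suc k} {suc i} (s≤s k≤i) = ≤⇒<ᵇ≡false k≤i

  coeff-mono⊗-≥ : ∀ t {k i} f → k ≤ i → coeff (mono p t k ⊗ f) i ≡ t * coeff f (i ∸ k)
  coeff-mono⊗-≥ t {k} {i} f k≤i = trans (coeff-mono⊗ t k f i) (cong (λ c → t * (if c then 0 else coeff f (i ∸ k))) (≤⇒<ᵇ≡false k≤i))

  module ReduceTop (f : Poly) (L≰e : length f ≰ e) where

    L k t : ℕ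
    L = length f
    k = L ∸ 1 ∸ e
    t = proj₁ (reduceTop f)

    f′ : Poly
    f′ = proj₂ (reduceTop f)

    1+[L-1]≡L : suc (L ∸ 1) ≡ L
    1+[L-1]≡L = m+[n∸m]≡n (≤-trans z<s (≰⇒> L≰e))

    e≤L-1 : e ≤ L ∸ 1
    e≤L-1 = ≤-pred (subst (suc e ≤_) (sym 1+[L-1]≡L) (≰⇒> L≰e))

    k≤L-1 : k ≤ L ∸ 1
    k≤L-1 = m∸n≤m (L ∸ 1) e

    length-f′ : length f′ ≡ L ∸ 1
    length-f′ = length-tabulate _ (L ∸ 1)

    top-coeff : (t * lc) % p ≡ coeff f (L ∸ 1) % p
    top-coeff = begin
      (t * lc) % p                               ≡⟨ %-cong-* (m%n%n≡m%n (coeff f (L ∸ 1) * lcInv) p) refl ⟩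
      (coeff f (L ∸ 1) * lcInv * lc) % p         ≡⟨ cong (_% p) (*-assoc (coeff f (L ∸ 1)) lcInv lc) ⟩
      (coeff f (L ∸ 1) * (lcInv * lc)) % p       ≡⟨ %-cong-* {coeff f (L ∸ 1)} refl (trans lcInv-inverse (sym (m<n⇒m%n≡m (FermatLittle.prime>1 pr)))) ⟩
      (coeff f (L ∸ 1) * 1) % p                  ≡⟨ cong (_% p) (*-identityʳ _) ⟩
      coeff f (L ∸ 1) % p                        ∎
      where open ≡-Reasoning

    reduceTop-correct : f ≈ f′ ⊕ mono p t k ⊗ b
    reduceTop-correct = mk≈ λ i → trans (coeff-by-cases i) (cong (_% p) (sym (coeff-⊕ f′ (mono p t k ⊗ b) i)))
      where
        coeff-by-cases : ∀ i → coeff f i % p ≡ (coeff f′ i + coeff (mono p t k ⊗ b) i) % p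
        coeff-by-cases i with <-cmp i (L ∸ 1)
        ... | tri< i<L-1 _ _ = sym (trans (cong₂ (λ u v → (u + v) % p) (coeff-tabulate _ (L ∸ 1) i<L-1) (coeff-mono⊗ t k b i))
                                          ([[a+[p∸x%p]]%p+x]%p≡a%p (coeff f i) _))
        ... | tri≈ _ refl _ = sym (begin
          (coeff f′ (L ∸ 1) + coeff (mono p t k ⊗ b) (L ∸ 1)) % p  ≡⟨ cong₂ (λ u v → (u + v) % p) (coeff-beyond f′ (≤-reflexive length-f′))
                                                                                               (coeff-mono⊗-≥ t b k≤L-1) ⟩
          (t * coeff b (L ∸ 1 ∸ k)) % p                          ≡⟨ cong (λ j → (t * coeff b j) % p) (m∸[m∸n]≡n e≤L-1) ⟩
          (t * lc) % p                                           ≡⟨ top-coeff ⟩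
          coeff f (L ∸ 1) % p                                    ∎)
          where open ≡-Reasoning
        ... | tri> _ _ L-1<i = begin
          coeff f i % p                                    ≡⟨ cong (_% p) (coeff-beyond f L≤i) ⟩
          0 % p                                            ≡⟨ cong (_% p) (*-zeroʳ t) ⟨
          (t * 0) % p                                      ≡⟨ cong (λ c → (t * c) % p) (coeff-beyond b beyond-b) ⟨
          (t * coeff b (i ∸ k)) % p                        ≡⟨ cong₂ (λ u v → (u + v) % p) (coeff-beyond f′ (≤-trans (≤-reflexive length-f′) (<⇒≤ L-1<i)))
                                                                                         (coeff-mono⊗-≥ t b (≤-trans k≤L-1 (<⇒≤ L-1<i))) ⟨
          (coeff f′ i + coeff (mono p t k ⊗ b) i) % p      ∎
          where
            open ≡-Reasoning
            L≤i : L ≤ i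
            L≤i = subst (_≤ i) 1+[L-1]≡L L-1<i
            beyond-b : length b ≤ i ∸ k
            beyond-b = ≤-trans (≤-reflexive length-b≡L∸k) (∸-monoˡ-≤ k L-1<i)
              where
                length-b≡L∸k : length b ≡ suc (L ∸ 1) ∸ k
                length-b≡L∸k = trans length-b (trans (cong suc (sym (m∸[m∸n]≡n e≤L-1))) (sym (+-∸-assoc 1 k≤L-1)))

  divmodF-correct : ∀ fuel f → f ≈ proj₁ (divmodF fuel f) ⊗ b ⊕ proj₂ (divmodF fuel f)
  divmodF-correct zero       f = 𝔽ₚ[X].refl
  divmodF-correct (suc fuel) f with length f ≤? e
  ... | yes _   = 𝔽ₚ[X].refl
  ... | no L≰e with divmodF fuel (ReduceTop.f′ f L≰e) | divmodF-correct fuel (ReduceTop.f′ f L≰e)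
  ...   | q , r | f′≈qb+r = begin
    f                           ≈⟨ reduceTop-correct ⟩
    f′ ⊕ m ⊗ b                  ≈⟨ ⊕-congʳ f′≈qb+r ⟩
    (q ⊗ b ⊕ r) ⊕ m ⊗ b         ≈⟨ solve-𝔽ₚ[X] 4 (λ q r m b → ((q :* b :+ r) :+ m :* b) ⊜ ((q :+ m) :* b :+ r)) 𝔽ₚ[X].refl q r m b ⟩
    (q ⊕ m) ⊗ b ⊕ r             ≈⟨ ⊕-congʳ (⊗-congʳ (addP≈⊕ q m)) ⟨
    addP p q m ⊗ b ⊕ r          ∎
    where
      open ReduceTop f L≰e
      open ≈-Reasoning
      m : Poly
      m = mono p t k

  divmodF-length-r : ∀ fuel f → length f ≤ fuel → length (proj₂ (divmodF fuel f)) ≤ e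
  divmodF-length-r zero       f L≤0    = ≤-trans L≤0 z≤n
  divmodF-length-r (suc fuel) f L≤1+fuel with length f ≤? e
  ... | yes L≤e = L≤e
  ... | no L≰e  = divmodF-length-r fuel (ReduceTop.f′ f L≰e)
                    (subst (_≤ fuel) (sym (ReduceTop.length-f′ f L≰e)) (∸-monoˡ-≤ 1 L≤1+fuel))

  divmodF-length-q : ∀ fuel f → length (proj₁ (divmodF fuel f)) ≤ length f ∸ e
  divmodF-length-q zero       f = z≤n
  divmodF-length-q (suc fuel) f with length f ≤? e
  ... | yes _   = z≤n
  ... | no L≰e with divmodF fuel (ReduceTop.f′ f L≰e) | divmodF-length-q fuel (ReduceTop.f′ f L≰e)
  ...   | q , r | length-q = subst (_≤ L ∸ e) (sym (length-tabulate _ (length q ⊔ length (mono p t k)))) (⊔-lub q-bound m-bound)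
    where
      open ReduceTop f L≰e
      q-bound : length q ≤ L ∸ e
      q-bound = ≤-trans length-q (≤-trans (≤-reflexive (cong (_∸ e) length-f′)) (∸-monoˡ-≤ e (m∸n≤m L 1)))
      m-bound : length (mono p t k) ≤ L ∸ e
      m-bound = ≤-reflexive (trans (length-mono t k) (trans (sym (+-∸-assoc 1 e≤L-1)) (cong (_∸ e) 1+[L-1]≡L)))

  divmodP-correct : ∀ f → f ≈ proj₁ (divmodP f) ⊗ b ⊕ proj₂ (divmodP f)
  divmodP-correct f = divmodF-correct (length f) f

  divmodP-length-r : ∀ f → length (proj₂ (divmodP f)) ≤ e
  divmodP-length-r f = divmodF-length-r (length f) f ≤-refl

  divmodP-length-q : ∀ f → length (proj₁ (divmodP f)) ≤ length f ∸ e
  divmodP-length-q f = divmodF-length-q (length f) f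

  -- Induction on D: as deg b = e, the coefficients of (d ∷ D) ⊗ b above e are those of D ⊗ b shifted by one,
  -- and then its coefficient e is d * lc.
  deg[D⊗b]<e⇒D≈[] : ∀ D → (∀ i → e ≤ i → coeff (D ⊗ b) i % p ≡ 0) → D ≈ []
  deg[D⊗b]<e⇒D≈[] []      _       = 𝔽ₚ[X].refl
  deg[D⊗b]<e⇒D≈[] (d ∷ D) high≡0 = ∷-≈[] d%p≡0 D≈[]
    where
      coeff-suc : ∀ i → e ≤ i → coeff ((d ∷ D) ⊗ b) (suc i) ≡ coeff (D ⊗ b) i
      coeff-suc i e≤i = begin
        coeff (d · b ⊕ (0 ∷ D ⊗ b)) (suc i)    ≡⟨ coeff-⊕ (d · b) _ (suc i) ⟩
        coeff (d · b) (suc i) + coeff (D ⊗ b) i ≡⟨ cong (_+ coeff (D ⊗ b) i) (coeff-· d b (suc i)) ⟩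
        d * coeff b (suc i) + coeff (D ⊗ b) i   ≡⟨ cong (λ c → d * c + coeff (D ⊗ b) i) (coeff-beyond b (subst (_≤ suc i) (sym length-b) (s≤s e≤i))) ⟩
        d * 0 + coeff (D ⊗ b) i                 ≡⟨ cong (_+ coeff (D ⊗ b) i) (*-zeroʳ d) ⟩
        coeff (D ⊗ b) i                         ∎
        where open ≡-Reasoning

      D≈[] : D ≈ []
      D≈[] = deg[D⊗b]<e⇒D≈[] D λ i e≤i → trans (cong (_% p) (sym (coeff-suc i e≤i))) (high≡0 (suc i) (m≤n⇒m≤1+n e≤i))

      d*lc%p≡0 : (d * lc) % p ≡ 0
      d*lc%p≡0 = begin
        (d * lc) % p                                        ≡⟨ cong (_% p) (+-identityʳ (d * lc)) ⟨
        (d * lc + 0) % p                                    ≡⟨ %-cong-+ {d * lc} refl (coeff-≈ 0∷D⊗b≈[] e) ⟨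
        (d * lc + coeff (0 ∷ D ⊗ b) e) % p                  ≡⟨ cong (λ c → (c + coeff (0 ∷ D ⊗ b) e) % p) (coeff-· d b e) ⟨
        (coeff (d · b) e + coeff (0 ∷ D ⊗ b) e) % p         ≡⟨ cong (_% p) (coeff-⊕ (d · b) _ e) ⟨
        coeff ((d ∷ D) ⊗ b) e % p                           ≡⟨ high≡0 e ≤-refl ⟩
        0                                                   ∎
        where
          open ≡-Reasoning
          0∷D⊗b≈[] : 0 ∷ D ⊗ b ≈ []
          0∷D⊗b≈[] = ∷-≈[] 0%p≡0 (⊗-congʳ D≈[])

      d%p≡0 : d % p ≡ 0
      d%p≡0 with euclidsLemma d lc pr (m%n≡0⇒n∣m (d * lc) p d*lc%p≡0)
      ... | inj₁ p∣d  = n∣m⇒m%n≡0 d p p∣d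
      ... | inj₂ p∣lc = contradiction (n∣m⇒m%n≡0 lc p p∣lc) lc%p≢0

  division-unique : ∀ {r r′ q q′} → length r ≤ e → length r′ ≤ e → r ⊕ b ⊗ q ≈ r′ ⊕ b ⊗ q′ → r ≈ r′ × q ≈ q′
  division-unique {r} {r′} {q} {q′} r<b r′<b r+bq≈r′+bq′ = r≈r′ , q≈q′
    where
      [q-q′]b≈r′-r : (q ⊕ neg q′) ⊗ b ≈ r′ ⊕ neg r
      [q-q′]b≈r′-r = begin
        (q ⊕ neg q′) ⊗ b                              ≈⟨ 𝔽ₚ[X].trans (𝔽ₚ[X].distribʳ b q (neg q′)) (𝔽ₚ[X].+-cong (𝔽ₚ[X].*-comm q b) b-q′≈-bq′) ⟩
        b ⊗ q ⊕ neg (b ⊗ q′)                          ≈⟨ 𝔽ₚ[X].+-identityˡ _ ⟨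
        [] ⊕ (b ⊗ q ⊕ neg (b ⊗ q′))                   ≈⟨ ⊕-congʳ (𝔽ₚ[X].-‿inverseʳ r) ⟨
        (r ⊕ neg r) ⊕ (b ⊗ q ⊕ neg (b ⊗ q′))          ≈⟨ 𝔽ₚ[X].+-interchange r (neg r) (b ⊗ q) (neg (b ⊗ q′)) ⟩
        (r ⊕ b ⊗ q) ⊕ (neg r ⊕ neg (b ⊗ q′))          ≈⟨ ⊕-congʳ r+bq≈r′+bq′ ⟩
        (r′ ⊕ b ⊗ q′) ⊕ (neg r ⊕ neg (b ⊗ q′))        ≈⟨ 𝔽ₚ[X].+-interchange r′ (b ⊗ q′) (neg r) (neg (b ⊗ q′)) ⟩
        (r′ ⊕ neg r) ⊕ (b ⊗ q′ ⊕ neg (b ⊗ q′))        ≈⟨ ⊕-congˡ (𝔽ₚ[X].-‿inverseʳ (b ⊗ q′)) ⟩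
        (r′ ⊕ neg r) ⊕ []                             ≈⟨ 𝔽ₚ[X].+-identityʳ _ ⟩
        r′ ⊕ neg r                                    ∎
        where
          open ≈-Reasoning
          b-q′≈-bq′ : neg q′ ⊗ b ≈ neg (b ⊗ q′)
          b-q′≈-bq′ = 𝔽ₚ[X].trans (𝔽ₚ[X].sym (𝔽ₚ[X].-‿distribˡ-* q′ b)) (𝔽ₚ[X].-‿cong (𝔽ₚ[X].*-comm q′ b))

      high-coeffs≡0 : ∀ i → e ≤ i → coeff ((q ⊕ neg q′) ⊗ b) i % p ≡ 0
      high-coeffs≡0 i e≤i = begin
        coeff ((q ⊕ neg q′) ⊗ b) i % p              ≡⟨ coeff-≈ [q-q′]b≈r′-r i ⟩
        coeff (r′ ⊕ neg r) i % p                    ≡⟨ cong (_% p) (trans (coeff-⊕ r′ (neg r) i) (cong (coeff r′ i +_) (coeff-· (p ∸ 1) r i))) ⟩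
        (coeff r′ i + (p ∸ 1) * coeff r i) % p      ≡⟨ cong₂ (λ u v → (u + (p ∸ 1) * v) % p)
                                                         (coeff-beyond r′ (≤-trans r′<b e≤i)) (coeff-beyond r (≤-trans r<b e≤i)) ⟩
        (0 + (p ∸ 1) * 0) % p                       ≡⟨ cong (_% p) (*-zeroʳ (p ∸ 1)) ⟩
        0 % p                                       ≡⟨ 0%p≡0 ⟩
        0                                           ∎
        where open ≡-Reasoning

      q≈q′ : q ≈ q′
      q≈q′ = 𝔽ₚ[X].x∙y⁻¹≈ε⇒x≈y q q′ (deg[D⊗b]<e⇒D≈[] (q ⊕ neg q′) high-coeffs≡0)

      r≈r′ : r ≈ r′
      r≈r′ = 𝔽ₚ[X].+-cancelʳ (b ⊗ q) r r′ (𝔽ₚ[X].trans r+bq≈r′+bq′ (⊕-congˡ {r′} (⊗-congˡ {b} (𝔽ₚ[X].sym q≈q′))))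

module EvalAtP (p : ℕ) .{{_ : NonZero p}} (p>1 : 1 ℕ.< p) where

  open import Data.Nat
  open import Data.Nat.Properties
  open import Data.Nat.DivMod
  open import Data.Nat.Divisibility using (divides)
  open import Data.List using ([]; _∷_; length)
  open import Relation.Binary.PropositionalEquality
  open ModArith p using (0%p≡0)
  open PolyRing p

  [x%p+p*y]%p≡x%p : ∀ x y → (x % p + p * y) % p ≡ x % p
  [x%p+p*y]%p≡x%p x y = trans (cong (λ z → (x % p + z) % p) (*-comm p y)) (trans ([m+kn]%n≡m%n (x % p) y p) (m%n%n≡m%n x p))

  [x%p+p*y]/p≡y : ∀ x y → (x % p + p * y) / p ≡ y
  [x%p+p*y]/p≡y x y = begin
    (x % p + p * y) / p      ≡⟨ +-distrib-/-∣ʳ (x % p) (divides y (*-comm p y)) ⟩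
    x % p / p + p * y / p    ≡⟨ cong₂ _+_ (m<n⇒m/n≡0 (m%n<n x p)) (trans (cong (_/ p) (*-comm p y)) (m*n/n≡m y p)) ⟩
    y                        ∎
    where open ≡-Reasoning

  evalAtP-≈[] : ∀ {f} → f ≈ [] → evalAtP p f ≡ 0
  evalAtP-≈[] {[]}    _    = refl
  evalAtP-≈[] {a ∷ f} f≈[] = begin
    a % p + p * evalAtP p f  ≡⟨ cong₂ (λ u v → u + p * v) (trans (coeff-≈ f≈[] 0) 0%p≡0) (evalAtP-≈[] {f} (mk≈ λ k → coeff-≈ f≈[] (suc k))) ⟩
    0 + p * 0                ≡⟨ *-zeroʳ p ⟩
    0                        ∎
    where open ≡-Reasoning

  evalAtP-cong : ∀ {f g} → f ≈ g → evalAtP p f ≡ evalAtP p g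
  evalAtP-cong {[]}    {g}     f≈g = sym (evalAtP-≈[] (𝔽ₚ[X].sym f≈g))
  evalAtP-cong {a ∷ f} {[]}    f≈g = evalAtP-≈[] f≈g
  evalAtP-cong {a ∷ f} {b ∷ g} f≈g = cong₂ (λ u v → u + p * v) (coeff-≈ f≈g 0) (evalAtP-cong {f} {g} (mk≈ λ k → coeff-≈ f≈g (suc k)))

  evalAtP<p^length : ∀ f → evalAtP p f < p ^ length f
  evalAtP<p^length []      = s≤s z≤n
  evalAtP<p^length (a ∷ f) = begin-strict
    a % p + p * evalAtP p f   <⟨ +-monoˡ-< (p * evalAtP p f) (m%n<n a p) ⟩
    p + p * evalAtP p f       ≡⟨ *-suc p (evalAtP p f) ⟨
    p * suc (evalAtP p f)     ≤⟨ *-monoʳ-≤ p (evalAtP<p^length f) ⟩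
    p * p ^ length f          ∎
    where open ≤-Reasoning

  length-digitPoly : ∀ k δ → length (digitPoly p k δ) ≡ k
  length-digitPoly zero    δ = refl
  length-digitPoly (suc k) δ = cong suc (length-digitPoly k (δ / p))

  evalAtP-digitPoly : ∀ k {δ} → δ < p ^ k → evalAtP p (digitPoly p k δ) ≡ δ
  evalAtP-digitPoly zero    δ<1   = sym (n<1⇒n≡0 δ<1)
  evalAtP-digitPoly (suc k) {δ} δ<p^1+k = begin
    δ % p % p + p * evalAtP p (digitPoly p k (δ / p))  ≡⟨ cong₂ _+_ (m%n%n≡m%n δ p) (cong (p *_) (evalAtP-digitPoly k δ/p<p^k)) ⟩
    δ % p + p * (δ / p)                               ≡⟨ cong (δ % p +_) (*-comm p (δ / p)) ⟩
    δ % p + δ / p * p                                 ≡⟨ m≡m%n+[m/n]*n δ p ⟨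
    δ                                                 ∎
    where
      open ≡-Reasoning
      δ/p<p^k : δ / p < p ^ k
      δ/p<p^k = m<n*o⇒m/o<n (subst (δ <_) (*-comm p (p ^ k)) δ<p^1+k)

  tail : Poly → Poly
  tail []      = []
  tail (a ∷ f) = f

  evalAtP%p : ∀ f → evalAtP p f % p ≡ coeff f 0 % p
  evalAtP%p []      = refl
  evalAtP%p (a ∷ f) = [x%p+p*y]%p≡x%p a (evalAtP p f)

  evalAtP/p : ∀ f → evalAtP p f / p ≡ evalAtP p (tail f)
  evalAtP/p []      = 0/n≡0 p
  evalAtP/p (a ∷ f) = [x%p+p*y]/p≡y a (evalAtP p f)

  evalAtP-injective : ∀ {f g} → evalAtP p f ≡ evalAtP p g → f ≈ g
  evalAtP-injective {f} {g} f≡g = mk≈ (λ k → coeff-≡ f g f≡g k)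
    where
      coeff-≡ : ∀ f g → evalAtP p f ≡ evalAtP p g → ∀ k → coeff f k % p ≡ coeff g k % p
      coeff-≡ f g f≡g zero    = trans (sym (evalAtP%p f)) (trans (cong (_% p) f≡g) (evalAtP%p g))
      coeff-≡ f g f≡g (suc k) = trans (coeff-tail f k) (trans (coeff-≡ (tail f) (tail g) tail≡ k) (sym (coeff-tail g k)))
        where
          tail≡ : evalAtP p (tail f) ≡ evalAtP p (tail g)
          tail≡ = trans (sym (evalAtP/p f)) (trans (cong (_/ p) f≡g) (evalAtP/p g))
          coeff-tail : ∀ h k → coeff h (suc k) % p ≡ coeff (tail h) k % p
          coeff-tail []      k = refl
          coeff-tail (a ∷ h) k = refl

  n<p^n : ∀ n → n < p ^ n
  n<p^n zero    = s≤s z≤n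
  n<p^n (suc n) = begin-strict
    suc n          ≤⟨ n<p^n n ⟩
    p ^ n          <⟨ m<m*n (p ^ n) p p>1 ⟩
    p ^ n * p      ≡⟨ *-comm (p ^ n) p ⟩
    p * p ^ n      ∎
    where
      open ≤-Reasoning
      instance _ = m^n≢0 p n

  nPoly-evalAtP : ∀ f → nPoly p (evalAtP p f) ≈ f
  nPoly-evalAtP f = evalAtP-injective (evalAtP-digitPoly (evalAtP p f) (n<p^n (evalAtP p f)))

module Normalisation (p : ℕ) .{{_ : NonZero p}} where

  open import Data.Nat
  open import Data.Nat.Properties
  open import Data.Nat.DivMod
  open import Data.List using ([]; _∷_; map; length)
  open import Data.List.Properties using (length-map)
  open import Data.Sum using (_⊎_; inj₁; inj₂)
  open import Relation.Nullary using (¬_)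
  open import Relation.Nullary.Negation using (contradiction)
  open import Relation.Binary.PropositionalEquality
  open ModArith p using (0%p≡0)
  open PolyRing p

  _∷ₙ_ : ℕ → Poly → Poly
  a     ∷ₙ (c ∷ g) = a ∷ c ∷ g
  zero  ∷ₙ []      = []
  suc a ∷ₙ []      = suc a ∷ []

  trim : Poly → Poly
  trim []      = []
  trim (a ∷ f) = a ∷ₙ trim f

  normalise : Poly → Poly
  normalise f = trim (map (_% p) f)

  Trimmed : Poly → Set
  Trimmed g = g ≡ [] ⊎ coeff g (length g ∸ 1) ≢ 0

  coeff-∷ₙ : ∀ a g k → coeff (a ∷ₙ g) k ≡ coeff (a ∷ g) k
  coeff-∷ₙ zero    []      zero    = refl
  coeff-∷ₙ zero    []      (suc k) = refl
  coeff-∷ₙ (suc a) []      k       = refl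
  coeff-∷ₙ a       (c ∷ g) k       = refl

  coeff-trim : ∀ f k → coeff (trim f) k ≡ coeff f k
  coeff-trim []      k       = refl
  coeff-trim (a ∷ f) zero    = coeff-∷ₙ a (trim f) zero
  coeff-trim (a ∷ f) (suc k) = trans (coeff-∷ₙ a (trim f) (suc k)) (coeff-trim f k)

  ∷ₙ-trimmed : ∀ a g → Trimmed g → Trimmed (a ∷ₙ g)
  ∷ₙ-trimmed zero    []      _          = inj₁ refl
  ∷ₙ-trimmed (suc a) []      _          = inj₂ λ ()
  ∷ₙ-trimmed a       (c ∷ g) (inj₁ ())
  ∷ₙ-trimmed a       (c ∷ g) (inj₂ top≢0) = inj₂ top≢0

  trim-trimmed : ∀ f → Trimmed (trim f)
  trim-trimmed []      = inj₁ refl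
  trim-trimmed (a ∷ f) = ∷ₙ-trimmed a (trim f) (trim-trimmed f)

  length-∷ₙ : ∀ a g → length (a ∷ₙ g) ≤ suc (length g)
  length-∷ₙ zero    []      = z≤n
  length-∷ₙ (suc a) []      = ≤-refl
  length-∷ₙ a       (c ∷ g) = ≤-refl

  length-trim : ∀ f → length (trim f) ≤ length f
  length-trim []      = z≤n
  length-trim (a ∷ f) = ≤-trans (length-∷ₙ a (trim f)) (s≤s (length-trim f))

  coeff-normalise : ∀ f k → coeff (normalise f) k ≡ coeff f k % p
  coeff-normalise f k = trans (coeff-trim (map (_% p) f) k) (coeff-map% f k)
    where
      coeff-map% : ∀ f k → coeff (map (_% p) f) k ≡ coeff f k % p
      coeff-map% []      k       = sym 0%p≡0
      coeff-map% (a ∷ f) zero    = refl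
      coeff-map% (a ∷ f) (suc k) = coeff-map% f k

  normalise≈ : ∀ f → normalise f ≈ f
  normalise≈ f = mk≈ λ k → trans (cong (_% p) (coeff-normalise f k)) (m%n%n≡m%n _ p)

  length-normalise : ∀ f → length (normalise f) ≤ length f
  length-normalise f = ≤-trans (length-trim (map (_% p) f)) (≤-reflexive (length-map _ f))

  normalise≡[]⇒≈[] : ∀ f → normalise f ≡ [] → f ≈ []
  normalise≡[]⇒≈[] f eq = 𝔽ₚ[X].trans (𝔽ₚ[X].sym (normalise≈ f)) (subst (_≈ []) (sym eq) 𝔽ₚ[X].refl)

  module _ (f : Poly) {c g} (eq : normalise f ≡ c ∷ g) where

    private
      top≢0 : coeff (normalise f) (length (normalise f) ∸ 1) ≢ 0
      top≢0 with trim-trimmed (map (_% p) f)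
      ... | inj₁ []≡ = contradiction (trans (sym []≡) eq) λ ()
      ... | inj₂ ≢0  = ≢0

    normalise≡∷⇒≉[] : ¬ f ≈ []
    normalise≡∷⇒≉[] f≈[] = top≢0 (trans (coeff-normalise f _) (trans (coeff-≈ f≈[] _) 0%p≡0))

    normalise≡∷⇒wellFormed : WellFormed p (c ∷ g)
    normalise≡∷⇒wellFormed = record
      { coeffs<p = λ k → subst (_< p) (trans (sym (coeff-normalise f k)) (cong (λ h → coeff h k) eq)) (m%n<n _ p)
      ; nonzero  = s≤s z≤n
      ; leading  = subst (λ h → coeff h (length h ∸ 1) ≢ 0) eq top≢0
      }

module Bezout (p : ℕ) .{{_ : NonZero p}} (pr : Prime p) where

  open import Data.Nat
  open import Data.Nat.Properties
  open import Data.Nat.DivMod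
  open import Data.List using ([]; _∷_; length)
  open import Data.Product using (Σ; _,_; proj₁; proj₂)
  open import Relation.Nullary using (¬_)
  open import Relation.Binary.PropositionalEquality
  open import Function using (_∘_)
  open ModArith p using (0%p≡0)
  open FermatLittle using (prime>1; ^[p∸2]-inverseˡ)
  open PolyRing p
  open Normalisation p
  open Division p using (divmodP)

  infix 4 _∣ₚ_

  _∣ₚ_ : Poly → Poly → Set
  g ∣ₚ f = Σ Poly λ w → g ⊗ w ≈ f

  record Gcd (A B : Poly) : Set where
    field
      gcd u v : Poly
      bezout  : gcd ≈ u ⊗ A ⊕ v ⊗ B
      gcd∣A   : gcd ∣ₚ A
      gcd∣B   : gcd ∣ₚ B
      gcd≉[]  : ¬ A ≈ [] → ¬ gcd ≈ []

  euclid : ∀ n A B → length (normalise B) < n → Gcd A B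
  euclid (suc n) A B |B|<1+n with normalise B in eq
  ... | [] = record
    { gcd = A ; u = one ; v = []
    ; bezout = 𝔽ₚ[X].sym (𝔽ₚ[X].trans (𝔽ₚ[X].+-identityʳ (one ⊗ A)) (𝔽ₚ[X].*-identityˡ A))
    ; gcd∣A  = one , 𝔽ₚ[X].*-identityʳ A
    ; gcd∣B  = [] , 𝔽ₚ[X].trans (𝔽ₚ[X].zeroʳ A) (𝔽ₚ[X].sym (normalise≡[]⇒≈[] B eq))
    ; gcd≉[] = λ A≉[] → A≉[]
    }
  ... | c ∷ g = record
    { gcd = R.gcd ; u = R.v ; v = R.u ⊕ neg (R.v ⊗ q)
    ; bezout = 𝔽ₚ[X].trans R.bezout (𝔽ₚ[X].sym bezout-step)
    ; gcd∣A  = q ⊗ proj₁ R.gcd∣A ⊕ proj₁ R.gcd∣B , gcd∣A-step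
    ; gcd∣B  = proj₁ R.gcd∣A , 𝔽ₚ[X].trans (proj₂ R.gcd∣A) B′≈B
    ; gcd≉[] = λ _ → R.gcd≉[] (normalise≡∷⇒≉[] B eq ∘ 𝔽ₚ[X].trans (𝔽ₚ[X].sym B′≈B))
    }
    where
      B′ : Poly
      B′ = c ∷ g
      B′≈B : B′ ≈ B
      B′≈B = subst (_≈ B) eq (normalise≈ B)
      module D = DivisionAlgorithm p pr B′ (normalise≡∷⇒wellFormed B eq)
      q r : Poly
      q = proj₁ (divmodP B′ A)
      r = proj₂ (divmodP B′ A)
      |r|<n : length (normalise r) < n
      |r|<n = ≤-<-trans (length-normalise r) (<-≤-trans (s≤s (D.divmodP-length-r A)) (≤-pred |B|<1+n))
      module R = Gcd (euclid n B′ r |r|<n)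

      bezout-step : R.v ⊗ A ⊕ (R.u ⊕ neg (R.v ⊗ q)) ⊗ B ≈ R.u ⊗ B′ ⊕ R.v ⊗ r
      bezout-step = begin
        R.v ⊗ A ⊕ (R.u ⊕ N) ⊗ B                                 ≈⟨ ⊕-cong (⊗-congˡ {R.v} (D.divmodP-correct A))
                                                                          (⊗-congˡ {R.u ⊕ N} (𝔽ₚ[X].sym B′≈B)) ⟩
        R.v ⊗ (q ⊗ B′ ⊕ r) ⊕ (R.u ⊕ N) ⊗ B′                     ≈⟨ solve-𝔽ₚ[X] 6 (λ v q B′ r u N → (v :* (q :* B′ :+ r) :+ (u :+ N) :* B′)
                                                                          ⊜ ((u :* B′ :+ v :* r) :+ ((v :* q) :* B′ :+ N :* B′))) 𝔽ₚ[X].refl R.v q B′ r R.u N ⟩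
        (R.u ⊗ B′ ⊕ R.v ⊗ r) ⊕ ((R.v ⊗ q) ⊗ B′ ⊕ N ⊗ B′)        ≈⟨ ⊕-congˡ {R.u ⊗ B′ ⊕ R.v ⊗ r} cancel ⟩
        (R.u ⊗ B′ ⊕ R.v ⊗ r) ⊕ []                               ≈⟨ 𝔽ₚ[X].+-identityʳ _ ⟩
        R.u ⊗ B′ ⊕ R.v ⊗ r                                      ∎
        where
          open ≈-Reasoning
          N : Poly
          N = neg (R.v ⊗ q)
          cancel : (R.v ⊗ q) ⊗ B′ ⊕ N ⊗ B′ ≈ []
          cancel = 𝔽ₚ[X].trans (𝔽ₚ[X].sym (𝔽ₚ[X].distribʳ B′ (R.v ⊗ q) N))
                     (𝔽ₚ[X].trans (⊗-congʳ {g = B′} (𝔽ₚ[X].-‿inverseʳ (R.v ⊗ q))) (𝔽ₚ[X].zeroˡ B′))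

      gcd∣A-step : R.gcd ⊗ (q ⊗ proj₁ R.gcd∣A ⊕ proj₁ R.gcd∣B) ≈ A
      gcd∣A-step = begin
        R.gcd ⊗ (q ⊗ w₁ ⊕ w₂)           ≈⟨ solve-𝔽ₚ[X] 4 (λ g q w₁ w₂ → (g :* (q :* w₁ :+ w₂)) ⊜ (q :* (g :* w₁) :+ g :* w₂))
                                                         𝔽ₚ[X].refl R.gcd q w₁ w₂ ⟩
        q ⊗ (R.gcd ⊗ w₁) ⊕ R.gcd ⊗ w₂   ≈⟨ ⊕-cong (⊗-congˡ {q} (proj₂ R.gcd∣A)) (proj₂ R.gcd∣B) ⟩
        q ⊗ B′ ⊕ r                       ≈⟨ D.divmodP-correct A ⟨
        A                                ∎
        where
          open ≈-Reasoning
          w₁ w₂ : Poly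
          w₁ = proj₁ R.gcd∣A
          w₂ = proj₁ R.gcd∣B

  Comaximal : Poly → Poly → Set
  Comaximal A B = Σ Poly λ u → Σ Poly λ v → u ⊗ A ⊕ v ⊗ B ≈ one

  -- The gcd divides both, so relative primality makes it a nonzero constant g₀; scale by g₀⁻¹ = g₀ ^ (p - 2).
  relPrime⇒comaximal : ∀ A B → ¬ A ≈ [] → RelPrime p A B → Comaximal A B
  relPrime⇒comaximal A B A≉[] A⊥B = g₀⁻¹ ⊗ G.u , g₀⁻¹ ⊗ G.v , (begin
    (g₀⁻¹ ⊗ G.u) ⊗ A ⊕ (g₀⁻¹ ⊗ G.v) ⊗ B   ≈⟨ solve-𝔽ₚ[X] 5 (λ w u A v B → ((w :* u) :* A :+ (w :* v) :* B) ⊜ (w :* (u :* A :+ v :* B)))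
                                               𝔽ₚ[X].refl g₀⁻¹ G.u A G.v B ⟩
    g₀⁻¹ ⊗ (G.u ⊗ A ⊕ G.v ⊗ B)             ≈⟨ ⊗-congˡ {g₀⁻¹} G.bezout ⟨
    g₀⁻¹ ⊗ G.gcd                           ≈⟨ ⊗-congˡ {g₀⁻¹} gcd≈g₀ ⟩
    g₀⁻¹ ⊗ (g₀ ∷ [])                       ≈⟨ mk≈ (λ { zero    → trans (cong (_% p) (+-identityʳ _)) (trans (^[p∸2]-inverseˡ pr g₀≢0) (sym 1%p≡1))
                                                     ; (suc k) → refl }) ⟩
    one                                    ∎)
    where
      open ≈-Reasoning
      module G = Gcd (euclid (suc (length (normalise B))) A B ≤-refl)
      toDivides : ∀ {f} → G.gcd ∣ₚ f → Divides p G.gcd f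
      toDivides (w , gw≈f) = w , λ k → trans (cong (_% p) (sym (coeff-⊗ G.gcd w k))) (coeff-≈ gw≈f k)
      high≡0 : ∀ k → 1 ≤ k → coeff G.gcd k % p ≡ 0
      high≡0 = A⊥B G.gcd (toDivides G.gcd∣A) (toDivides G.gcd∣B)
      g₀ : ℕ
      g₀ = coeff G.gcd 0
      gcd≈g₀ : G.gcd ≈ g₀ ∷ []
      gcd≈g₀ = mk≈ λ { zero → refl ; (suc k) → trans (high≡0 (suc k) (s≤s z≤n)) (sym 0%p≡0) }
      g₀≢0 : g₀ % p ≢ 0
      g₀≢0 g₀≡0 = G.gcd≉[] A≉[] (𝔽ₚ[X].trans gcd≈g₀ (∷-≈[] g₀≡0 𝔽ₚ[X].refl))
      g₀⁻¹ : Poly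
      g₀⁻¹ = g₀ ^ (p ∸ 2) ∷ []
      1%p≡1 : 1 % p ≡ 1
      1%p≡1 = m<n⇒m%n≡m (prime>1 pr)

  comaximal-sym : ∀ {A B} → Comaximal A B → Comaximal B A
  comaximal-sym {A} {B} (u , v , uA+vB≈1) = v , u , 𝔽ₚ[X].trans (𝔽ₚ[X].+-comm (v ⊗ B) (u ⊗ A)) uA+vB≈1

  comaximal-one : ∀ A → Comaximal A one
  comaximal-one A = [] , one , 𝔽ₚ[X].*-identityˡ one

  comaximal-⊗ : ∀ {A B C} → Comaximal A B → Comaximal A C → Comaximal A (B ⊗ C)
  comaximal-⊗ {A} {B} {C} (u , v , uA+vB≈1) (u′ , v′ , u′A+v′C≈1) = u ⊗ u′ ⊗ A ⊕ u ⊗ v′ ⊗ C ⊕ v ⊗ B ⊗ u′ , v ⊗ v′ , (begin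
    (u ⊗ u′ ⊗ A ⊕ u ⊗ v′ ⊗ C ⊕ v ⊗ B ⊗ u′) ⊗ A ⊕ (v ⊗ v′) ⊗ (B ⊗ C)
      ≈⟨ solve-𝔽ₚ[X] 7 (λ u v u′ v′ A B C → ((u :* u′ :* A :+ u :* v′ :* C :+ v :* B :* u′) :* A :+ (v :* v′) :* (B :* C))
                                             ⊜ ((u :* A :+ v :* B) :* (u′ :* A :+ v′ :* C))) 𝔽ₚ[X].refl u v u′ v′ A B C ⟩
    (u ⊗ A ⊕ v ⊗ B) ⊗ (u′ ⊗ A ⊕ v′ ⊗ C)   ≈⟨ ⊗-cong uA+vB≈1 u′A+v′C≈1 ⟩
    one ⊗ one                             ≈⟨ 𝔽ₚ[X].*-identityˡ one ⟩
    one                                   ∎)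
    where open ≈-Reasoning

module ChineseRemainder (p : ℕ) .{{_ : NonZero p}} (pr : Prime p) where

  open import Data.Nat
  open import Data.Nat.Properties
  open import Data.Nat.DivMod using (m<n⇒m%n≡m)
  open import Data.Nat.Divisibility using (m%n≡0⇒n∣m; n∣m⇒m%n≡0)
  open import Data.Nat.Primality using (euclidsLemma)
  open import Data.Fin using (Fin; zero; suc)
  import Data.Fin.Properties as Fin
  open import Data.List using ([]; _∷_; length)
  open import Data.List.Properties using (length-map)
  open import Data.Product using (Σ; _×_; _,_; proj₁; proj₂)
  open import Data.Sum using (inj₁; inj₂)
  open import Relation.Nullary using (¬_)
  open import Relation.Nullary.Negation using (contradiction)
  open import Relation.Binary.PropositionalEquality
  open import Function using (_∘_)
  open import Algebra.Definitions.RawMonoid +-0-rawMonoid using () renaming (sum to Σℕ)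
  open ModArith p using (0%p≡0)
  open PolyRing p
  open Normalisation p
  open Bezout p pr
  open Division p using (divmodP)
  open import Algebra.Definitions.RawMonoid 𝔽ₚ[X].*-rawMonoid using () renaming (sum to ∏)

  record HasDegree (A : Poly) (d : ℕ) : Set where
    constructor hasDegree
    field
      length≡ : length A ≡ suc d
      top≢0   : coeff A d % p ≢ 0

  length-⊕ : ∀ f g → length (f ⊕ g) ≡ length f ⊔ length g
  length-⊕ []      g       = refl
  length-⊕ (a ∷ f) []      = refl
  length-⊕ (a ∷ f) (b ∷ g) = cong suc (length-⊕ f g)

  length-∷⊗ : ∀ a f g → 1 ≤ length g → length ((a ∷ f) ⊗ g) ≡ length f + length g
  length-∷⊗ a []      g 1≤|g| = trans (length-⊕ (a · g) (0 ∷ [])) (trans (cong (_⊔ 1) (length-map _ g)) (m≥n⇒m⊔n≡m 1≤|g|))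
  length-∷⊗ a (c ∷ f) g 1≤|g| = trans (length-⊕ (a · g) (0 ∷ (c ∷ f) ⊗ g))
    (trans (cong₂ _⊔_ (length-map _ g) (cong suc (length-∷⊗ c f g 1≤|g|)))
           (m≤n⇒m⊔n≡n (≤-trans (m≤n+m (length g) (length f)) (n≤1+n _))))

  coeff-⊗-top : ∀ f g d d′ → length f ≡ suc d → length g ≡ suc d′ → coeff (f ⊗ g) (d + d′) ≡ coeff f d * coeff g d′
  coeff-⊗-top (a ∷ [])    g zero    d′ _ _ = trans (coeff-⊕ (a · g) (0 ∷ []) d′) (trans (cong₂ _+_ (coeff-· a g d′) (coeff-0∷[] d′)) (+-identityʳ _))
  coeff-⊗-top (a ∷ c ∷ f) g (suc d) d′ |f|≡ |g|≡ = begin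
    coeff (a · g ⊕ (0 ∷ (c ∷ f) ⊗ g)) (suc d + d′)             ≡⟨ coeff-⊕ (a · g) _ (suc d + d′) ⟩
    coeff (a · g) (suc d + d′) + coeff ((c ∷ f) ⊗ g) (d + d′)   ≡⟨ cong₂ _+_ (coeff-· a g (suc d + d′))
                                                                             (coeff-⊗-top (c ∷ f) g d d′ (suc-injective |f|≡) |g|≡) ⟩
    a * coeff g (suc d + d′) + coeff (c ∷ f) d * coeff g d′     ≡⟨ cong (λ x → a * x + coeff (c ∷ f) d * coeff g d′) (coeff-beyond g |g|≤) ⟩
    a * 0 + coeff (c ∷ f) d * coeff g d′                        ≡⟨ cong (_+ coeff (c ∷ f) d * coeff g d′) (*-zeroʳ a) ⟩
    coeff (c ∷ f) d * coeff g d′                                ∎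
    where
      open ≡-Reasoning
      |g|≤ : length g ≤ suc d + d′
      |g|≤ = subst (_≤ suc d + d′) (sym |g|≡) (s≤s (m≤n+m d′ d))

  *-%≢0 : ∀ {x y} → x % p ≢ 0 → y % p ≢ 0 → (x * y) % p ≢ 0
  *-%≢0 {x} {y} x≢0 y≢0 xy≡0 with euclidsLemma x y pr (m%n≡0⇒n∣m _ p xy≡0)
  ... | inj₁ p∣x = x≢0 (n∣m⇒m%n≡0 x p p∣x)
  ... | inj₂ p∣y = y≢0 (n∣m⇒m%n≡0 y p p∣y)

  HasDegree-⊗ : ∀ {A B d d′} → HasDegree A d → HasDegree B d′ → HasDegree (A ⊗ B) (d + d′)
  HasDegree-⊗ {a ∷ A} {B} {d} {d′} (hasDegree |A|≡ topA≢0) (hasDegree |B|≡ topB≢0) = hasDegree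
    (trans (length-∷⊗ a A B (subst (1 ≤_) (sym |B|≡) (s≤s z≤n))) (trans (cong₂ _+_ (cong pred |A|≡) |B|≡) (+-suc d d′)))
    (λ top≡0 → *-%≢0 topA≢0 topB≢0 (trans (cong (_% p) (sym (coeff-⊗-top (a ∷ A) B d d′ |A|≡ |B|≡))) top≡0))

  HasDegree-one : HasDegree one 0
  HasDegree-one = hasDegree refl λ 1%p≡0 → contradiction (trans (sym (m<n⇒m%n≡m (FermatLittle.prime>1 pr))) 1%p≡0) λ ()

  HasDegree⇒≉[] : ∀ {A d} → HasDegree A d → ¬ A ≈ []
  HasDegree⇒≉[] {A} {d} (hasDegree _ top≢0) A≈[] = top≢0 (trans (coeff-≈ A≈[] d) 0%p≡0)

  HasDegree-∏ : ∀ {d} (M : Fin d → Poly) (dg : Fin d → ℕ) → (∀ i → HasDegree (M i) (dg i)) → HasDegree (∏ M) (Σℕ dg)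
  HasDegree-∏ {zero}  M dg deg-M = HasDegree-one
  HasDegree-∏ {suc d} M dg deg-M = HasDegree-⊗ (deg-M zero) (HasDegree-∏ (λ i → M (suc i)) (λ i → dg (suc i)) (λ i → deg-M (suc i)))

  HasDegree-^ : ∀ {B e} k → HasDegree B e → HasDegree (B ^ᵖ k) (k * e)
  HasDegree-^ zero    deg-B = HasDegree-one
  HasDegree-^ (suc k) deg-B = HasDegree-⊗ deg-B (HasDegree-^ k deg-B)

  comaximal-∏ : ∀ {A d} (M : Fin d → Poly) → (∀ j → Comaximal A (M j)) → Comaximal A (∏ M)
  comaximal-∏ {A} {zero}  M _         = comaximal-one A
  comaximal-∏ {A} {suc d} M A⊥M = comaximal-⊗ (A⊥M zero) (comaximal-∏ (λ i → M (suc i)) (λ i → A⊥M (suc i)))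

  comaximal-^ : ∀ {A B} k → Comaximal A B → Comaximal A (B ^ᵖ k)
  comaximal-^ {A} zero    _   = comaximal-one A
  comaximal-^     (suc k) A⊥B = comaximal-⊗ A⊥B (comaximal-^ k A⊥B)

  ∏-factor : ∀ {d} (M : Fin d → Poly) j → Σ Poly λ R → ∏ M ≈ M j ⊗ R
  ∏-factor M zero    = ∏ (λ i → M (suc i)) , 𝔽ₚ[X].refl
  ∏-factor M (suc j) with ∏-factor (λ i → M (suc i)) j
  ... | R , ∏≈MjR = M zero ⊗ R , 𝔽ₚ[X].trans (⊗-congˡ {M zero} ∏≈MjR) (𝔽ₚ[X].*-left-comm (M zero) (M (suc j)) R)

  infix 4 _≈_mod_
  infix 1 _by_

  record _≈_mod_ (X Y M : Poly) : Set where
    constructor _by_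
    field
      quotient : Poly
      ≈+multiple : X ≈ Y ⊕ M ⊗ quotient

  ≈⇒≈mod : ∀ {X Y M} → X ≈ Y → X ≈ Y mod M
  ≈⇒≈mod {X} {Y} {M} X≈Y = [] by 𝔽ₚ[X].trans X≈Y (𝔽ₚ[X].sym (𝔽ₚ[X].trans (⊕-congˡ {Y} (𝔽ₚ[X].zeroʳ M)) (𝔽ₚ[X].+-identityʳ Y)))

  mod-sym : ∀ {X Y M} → X ≈ Y mod M → Y ≈ X mod M
  mod-sym {X} {Y} {M} (w by X≈Y+Mw) = neg w by (begin
    Y                              ≈⟨ 𝔽ₚ[X].+-identityʳ Y ⟨
    Y ⊕ []                         ≈⟨ ⊕-congˡ {Y} (𝔽ₚ[X].-‿inverseʳ (M ⊗ w)) ⟨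
    Y ⊕ (M ⊗ w ⊕ neg (M ⊗ w))      ≈⟨ 𝔽ₚ[X].+-assoc Y (M ⊗ w) _ ⟨
    Y ⊕ M ⊗ w ⊕ neg (M ⊗ w)        ≈⟨ ⊕-cong (𝔽ₚ[X].sym X≈Y+Mw) (𝔽ₚ[X].-‿distribʳ-* M w) ⟩
    X ⊕ M ⊗ neg w                  ∎)
    where open ≈-Reasoning

  mod-trans : ∀ {X Y Z M} → X ≈ Y mod M → Y ≈ Z mod M → X ≈ Z mod M
  mod-trans {X} {Y} {Z} {M} (w by X≈Y+Mw) (w′ by Y≈Z+Mw′) = w′ ⊕ w by (begin
    X                        ≈⟨ X≈Y+Mw ⟩
    Y ⊕ M ⊗ w                ≈⟨ ⊕-congʳ Y≈Z+Mw′ ⟩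
    Z ⊕ M ⊗ w′ ⊕ M ⊗ w       ≈⟨ solve-𝔽ₚ[X] 4 (λ Z M w′ w → ((Z :+ M :* w′) :+ M :* w) ⊜ (Z :+ M :* (w′ :+ w))) 𝔽ₚ[X].refl Z M w′ w ⟩
    Z ⊕ M ⊗ (w′ ⊕ w)         ∎)
    where open ≈-Reasoning

  mod-⊗ʳ : ∀ {X Y N R} → X ≈ Y mod N ⊗ R → X ≈ Y mod N
  mod-⊗ʳ {Y = Y} {N} {R} (w by X≈Y+NRw) = R ⊗ w by 𝔽ₚ[X].trans X≈Y+NRw (⊕-congˡ {Y} (𝔽ₚ[X].*-assoc N R w))

  mod-cong : ∀ {X Y M N} → M ≈ N → X ≈ Y mod M → X ≈ Y mod N
  mod-cong {Y = Y} M≈N (w by X≈Y+Mw) = w by 𝔽ₚ[X].trans X≈Y+Mw (⊕-congˡ {Y} (⊗-congʳ M≈N))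

  -- With u A + v B ≈ 1, the combination S (v B) + T (u A) differs from S (u A + v B) ≈ S by a multiple of A.
  bezout-combination : ∀ {A B u v} S T → u ⊗ A ⊕ v ⊗ B ≈ one → S ⊗ (v ⊗ B) ⊕ T ⊗ (u ⊗ A) ≈ S mod A
  bezout-combination {A} {B} {u} {v} S T uA+vB≈1 = u ⊗ (T ⊕ neg S) by (begin
    G                                              ≈⟨ 𝔽ₚ[X].+-identityʳ G ⟨
    G ⊕ []                                         ≈⟨ ⊕-congˡ {G} (𝔽ₚ[X].zeroˡ (u ⊗ A)) ⟨
    G ⊕ [] ⊗ (u ⊗ A)                               ≈⟨ ⊕-congˡ {G} (⊗-congʳ (𝔽ₚ[X].-‿inverseʳ S)) ⟨
    G ⊕ (S ⊕ neg S) ⊗ (u ⊗ A)                      ≈⟨ solve-𝔽ₚ[X] 7 (λ S T u v A B nS →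
                                                         ((S :* (v :* B) :+ T :* (u :* A)) :+ (S :+ nS) :* (u :* A))
                                                         ⊜ (S :* (u :* A :+ v :* B) :+ A :* (u :* (T :+ nS))))
                                                       𝔽ₚ[X].refl S T u v A B (neg S) ⟩
    S ⊗ (u ⊗ A ⊕ v ⊗ B) ⊕ A ⊗ (u ⊗ (T ⊕ neg S))    ≈⟨ ⊕-congʳ (𝔽ₚ[X].trans (⊗-congˡ {S} uA+vB≈1) (𝔽ₚ[X].*-identityʳ S)) ⟩
    S ⊕ A ⊗ (u ⊗ (T ⊕ neg S))                      ∎)
    where
      open ≈-Reasoning
      G : Poly
      G = S ⊗ (v ⊗ B) ⊕ T ⊗ (u ⊗ A)

  crt-pair : ∀ {A B} → Comaximal A B → ∀ S T → Σ Poly λ G → G ≈ S mod A × G ≈ T mod B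
  crt-pair {A} {B} (u , v , uA+vB≈1) S T =
    S ⊗ (v ⊗ B) ⊕ T ⊗ (u ⊗ A) ,
    bezout-combination {A} {B} {u} {v} S T uA+vB≈1 ,
    mod-trans (≈⇒≈mod (𝔽ₚ[X].+-comm (S ⊗ (v ⊗ B)) (T ⊗ (u ⊗ A))))
              (bezout-combination {B} {A} {v} {u} T S (𝔽ₚ[X].trans (𝔽ₚ[X].+-comm (v ⊗ B) (u ⊗ A)) uA+vB≈1))

  reduce-mod : ∀ {A d} → HasDegree A d → ∀ G → Σ Poly λ F → length F ≤ d × F ≈ G mod A
  reduce-mod {A} {d} deg-A G with normalise A in eq
  ... | []    = contradiction (normalise≡[]⇒≈[] A eq) (HasDegree⇒≉[] deg-A)
  ... | c ∷ g = F , |F|≤d , mod-cong A′≈A F≈G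
    where
      A′ : Poly
      A′ = c ∷ g
      A′≈A : A′ ≈ A
      A′≈A = subst (_≈ A) eq (normalise≈ A)
      module D = DivisionAlgorithm p pr A′ (normalise≡∷⇒wellFormed A eq)
      F = proj₂ (divmodP A′ G)
      |F|≤d : length F ≤ d
      |F|≤d = ≤-trans (D.divmodP-length-r G)
                (≤-trans (∸-monoˡ-≤ 1 (subst (λ h → length h ≤ length A) eq (length-normalise A)))
                         (≤-reflexive (cong pred (HasDegree.length≡ deg-A))))
      F≈G : F ≈ G mod A′
      F≈G = mod-sym (proj₁ (divmodP A′ G) by 𝔽ₚ[X].trans (D.divmodP-correct G)
              (𝔽ₚ[X].trans (𝔽ₚ[X].+-comm _ F) (⊕-congˡ {F} (𝔽ₚ[X].*-comm _ A′))))

  crt : ∀ {d} (M T : Fin d → Poly) (dg : Fin d → ℕ) → (∀ i → HasDegree (M i) (dg i)) →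
        (∀ i j → i ≢ j → Comaximal (M i) (M j)) →
        Σ Poly λ F → length F ≤ Σℕ dg × (∀ i → F ≈ T i mod M i)
  crt {zero}  M T dg _     _      = [] , z≤n , λ ()
  crt {suc d} M T dg deg-M M⊥M = F , |F|≤ , F≈T
    where
      P′ : Poly
      P′ = ∏ (M ∘ suc)
      tail-solution : Σ Poly λ F′ → length F′ ≤ Σℕ (dg ∘ suc) × (∀ i → F′ ≈ T (suc i) mod M (suc i))
      tail-solution = crt (M ∘ suc) (T ∘ suc) (dg ∘ suc) (deg-M ∘ suc) (λ i j i≢j → M⊥M (suc i) (suc j) (i≢j ∘ Fin.suc-injective))
      pair : Σ Poly λ G → G ≈ T zero mod M zero × G ≈ proj₁ tail-solution mod P′
      pair = crt-pair (comaximal-∏ (M ∘ suc) (λ j → M⊥M zero (suc j) λ ())) (T zero) (proj₁ tail-solution)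
      reduced : Σ Poly λ F → length F ≤ Σℕ dg × F ≈ proj₁ pair mod M zero ⊗ P′
      reduced = reduce-mod (HasDegree-∏ M dg deg-M) (proj₁ pair)
      F : Poly
      F = proj₁ reduced
      |F|≤ : length F ≤ Σℕ dg
      |F|≤ = proj₁ (proj₂ reduced)
      F≈T : ∀ i → F ≈ T i mod M i
      F≈T zero    = mod-trans (mod-⊗ʳ (proj₂ (proj₂ reduced))) (proj₁ (proj₂ pair))
      F≈T (suc j) = mod-trans (mod-⊗ʳ (mod-cong P′≈MR (mod-⊗ʳ (mod-cong (𝔽ₚ[X].*-comm (M zero) P′) (proj₂ (proj₂ reduced))))))
                      (mod-trans (mod-⊗ʳ (mod-cong P′≈MR (proj₂ (proj₂ pair)))) (proj₂ (proj₂ tail-solution) j))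
        where
          P′≈MR : P′ ≈ M (suc j) ⊗ proj₁ (∏-factor (M ∘ suc) j)
          P′≈MR = proj₂ (∏-factor (M ∘ suc) j)

module NatToRational where

  open import Data.Nat as ℕ using (ℕ; suc; NonZero)
  import Data.Nat.Properties as ℕ
  open import Data.Integer as ℤ using (ℤ; +_)
  import Data.Integer.Properties as ℤ
  open import Data.Integer.GCD using (gcd)
  open import Data.Integer.Solver using (module +-*-Solver)
  open import Data.Rational as ℚ using (ℚ; 0ℚ; 1ℚ; _/_; _+_; _*_; _≤_; ↥_; ↧_; toℚᵘ)
  open import Data.Product using (_×_)
  import Data.Rational.Properties as ℚ
  open import Data.Rational.Unnormalised as ℚᵘ using (ℚᵘ; mkℚᵘ; *≡*; _≃_)
  import Data.Rational.Unnormalised.Properties as ℚᵘ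
  open import Relation.Binary.PropositionalEquality
  open +-*-Solver using (solve; _:+_; _:*_; _:=_; con)

  ⟦_⟧ : ℕ → ℚ
  ⟦_⟧ = ℕtoℚ

  toℚᵘ-/ : ∀ i n .{{_ : NonZero n}} → toℚᵘ (i / n) ≃ mkℚᵘ i (n ℕ.∸ 1)
  toℚᵘ-/ i (suc n) = *≡* (begin
    ℚᵘ.↥ (toℚᵘ r) ℤ.* + suc n      ≡⟨ cong (ℤ._* + suc n) (ℚ.↥ᵘ-toℚᵘ r) ⟩
    ↥ r ℤ.* + suc n                ≡⟨ cong (↥ r ℤ.*_) (ℚ.↧-/ i (suc n)) ⟨
    ↥ r ℤ.* (↧ r ℤ.* g)            ≡⟨ solve 3 (λ a b c → a :* (b :* c) := (a :* c) :* b) refl (↥ r) (↧ r) g ⟩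
    (↥ r ℤ.* g) ℤ.* ↧ r            ≡⟨ cong (ℤ._* ↧ r) (ℚ.↥-/ i (suc n)) ⟩
    i ℤ.* ↧ r                      ≡⟨ cong (i ℤ.*_) (ℚ.↧ᵘ-toℚᵘ r) ⟨
    i ℤ.* ℚᵘ.↧ (toℚᵘ r)            ∎)
    where
      open ≡-Reasoning
      r : ℚ
      r = i / suc n
      g : ℤ
      g = gcd i (+ suc n)

  toℚᵘ-ℕtoℚ : ∀ n → toℚᵘ (ℕtoℚ n) ≃ mkℚᵘ (+ n) 0
  toℚᵘ-ℕtoℚ n = toℚᵘ-/ (+ n) 1

  ≃⇒≡ℕtoℚ : ∀ {x} n → toℚᵘ x ≃ mkℚᵘ (+ n) 0 → x ≡ ℕtoℚ n
  ≃⇒≡ℕtoℚ n x≃n = ℚ.toℚᵘ-injective (ℚᵘ.≃-trans x≃n (ℚᵘ.≃-sym (toℚᵘ-ℕtoℚ n)))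

  ℕtoℚ-+ : ∀ m n → ℕtoℚ (m ℕ.+ n) ≡ ℕtoℚ m + ℕtoℚ n
  ℕtoℚ-+ m n = sym (≃⇒≡ℕtoℚ (m ℕ.+ n) (ℚᵘ.≃-trans (ℚ.toℚᵘ-homo-+ (ℕtoℚ m) (ℕtoℚ n))
                                 (ℚᵘ.≃-trans (ℚᵘ.+-cong (toℚᵘ-ℕtoℚ m) (toℚᵘ-ℕtoℚ n))
                                             (*≡* (solve 2 (λ x y → (x :* con (+ 1) :+ y :* con (+ 1)) :* con (+ 1) := (x :+ y) :* con (+ 1))
                                                           refl (+ m) (+ n))))))

  ℕtoℚ-* : ∀ m n → ℕtoℚ (m ℕ.* n) ≡ ℕtoℚ m * ℕtoℚ n
  ℕtoℚ-* m n = sym (≃⇒≡ℕtoℚ (m ℕ.* n) (ℚᵘ.≃-trans (ℚ.toℚᵘ-homo-* (ℕtoℚ m) (ℕtoℚ n))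
                                 (ℚᵘ.≃-trans (ℚᵘ.*-cong (toℚᵘ-ℕtoℚ m) (toℚᵘ-ℕtoℚ n))
                                             (*≡* (cong (ℤ._* + 1) (ℤ.+◃n≡+n (m ℕ.* n)))))))

  ℕtoℚ*/≡ : ∀ Z .{{_ : NonZero Z}} a → ℕtoℚ Z * ((+ a) / Z) ≡ ℕtoℚ a
  ℕtoℚ*/≡ (suc z) a = ≃⇒≡ℕtoℚ a (ℚᵘ.≃-trans (ℚ.toℚᵘ-homo-* (ℕtoℚ (suc z)) ((+ a) / suc z))
                                 (ℚᵘ.≃-trans (ℚᵘ.*-cong (toℚᵘ-ℕtoℚ (suc z)) (toℚᵘ-/ (+ a) (suc z)))
                                             (*≡* (trans (solve 2 (λ x y → (x :* y) :* con (+ 1) := y :* x) refl (+ suc z) (+ a))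
                                                         (cong (λ w → + a ℤ.* + w) (sym (ℕ.+-identityʳ (suc z))))))))

  ℕtoℚ-nonNeg : ∀ n → 0ℚ ≤ ℕtoℚ n
  ℕtoℚ-nonNeg n = ℚ.nonNegative⁻¹ (ℕtoℚ n) {{ℚ.normalize-nonNeg n 1}}

  /-nonNeg : ∀ a Z .{{_ : NonZero Z}} → 0ℚ ≤ (+ a) / Z
  /-nonNeg a Z = ℚ.nonNegative⁻¹ _ {{ℚ.normalize-nonNeg a Z}}

  ℕtoℚ-mono-≤ : ∀ {m n} → m ℕ.≤ n → ℕtoℚ m ≤ ℕtoℚ n
  ℕtoℚ-mono-≤ {m} {n} m≤n = begin
    ℕtoℚ m                          ≡⟨ ℚ.+-identityʳ (ℕtoℚ m) ⟨
    ℕtoℚ m + 0ℚ                     ≤⟨ ℚ.+-monoʳ-≤ (ℕtoℚ m) (ℕtoℚ-nonNeg (n ℕ.∸ m)) ⟩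
    ℕtoℚ m + ℕtoℚ (n ℕ.∸ m)         ≡⟨ ℕtoℚ-+ m (n ℕ.∸ m) ⟨
    ℕtoℚ (m ℕ.+ (n ℕ.∸ m))          ≡⟨ cong ℕtoℚ (ℕ.m+[n∸m]≡n m≤n) ⟩
    ℕtoℚ n                          ∎
    where open ℚ.≤-Reasoning

  ℕtoℚ-pos : ∀ n .{{_ : NonZero n}} → ℚ.Positive (ℕtoℚ n)
  ℕtoℚ-pos (suc n) = ℚ.normalize-pos (suc n) 1

  InCell : ℕ → ℕ → ℚ → Set
  InCell c Q y = ℕtoℚ c ≤ ℕtoℚ Q * y × ℕtoℚ Q * y ≤ ℕtoℚ c + 1ℚ

module RationalFacts where

  open import Data.Nat as ℕ using (ℕ; zero; suc)
  open import Data.Fin using (Fin; zero; suc)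
  open import Data.Rational as ℚ using (ℚ; 0ℚ; 1ℚ; _≤_; _+_; _*_; _-_; -_)
  import Data.Rational.Properties as ℚ
  open import Data.Rational.Solver using (module +-*-Solver)
  open import Data.Sum using (inj₁; inj₂)
  open import Relation.Binary.PropositionalEquality
  open +-*-Solver using (solve; _:*_; :-_; _:=_)
  open NatToRational

  0≤x*y : ∀ {x y} → 0ℚ ≤ x → 0ℚ ≤ y → 0ℚ ≤ x * y
  0≤x*y {x} {y} 0≤x 0≤y = ℚ.nonNegative⁻¹ (x * y) {{ℚ.nonNeg*nonNeg⇒nonNeg x {{ℚ.nonNegative 0≤x}} y {{ℚ.nonNegative 0≤y}}}}

  *-monoˡ-≤-nonNeg : ∀ {x y z} → 0ℚ ≤ x → y ≤ z → x * y ≤ x * z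
  *-monoˡ-≤-nonNeg {x} 0≤x = ℚ.*-monoˡ-≤-nonNeg x {{ℚ.nonNegative 0≤x}}

  *-monoʳ-≤-nonNeg : ∀ {x y z} → 0ℚ ≤ x → y ≤ z → y * x ≤ z * x
  *-monoʳ-≤-nonNeg {x} 0≤x = ℚ.*-monoʳ-≤-nonNeg x {{ℚ.nonNegative 0≤x}}

  0≤x*x : ∀ x → 0ℚ ≤ x * x
  0≤x*x x with ℚ.≤-total 0ℚ x
  ... | inj₁ 0≤x = 0≤x*y 0≤x 0≤x
  ... | inj₂ x≤0 = subst (0ℚ ≤_) (solve 1 (λ x → (:- x) :* (:- x) := x :* x) refl x) (0≤x*y 0≤-x 0≤-x)
    where
      0≤-x : 0ℚ ≤ - x
      0≤-x = ℚ.neg-antimono-≤ x≤0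

  -1≤x≤1⇒x*x≤1 : ∀ {x} → - 1ℚ ≤ x → x ≤ 1ℚ → x * x ≤ 1ℚ
  -1≤x≤1⇒x*x≤1 {x} -1≤x x≤1 with ℚ.≤-total 0ℚ x
  ... | inj₁ 0≤x = ℚ.≤-trans (*-monoˡ-≤-nonNeg 0≤x x≤1) (ℚ.≤-trans (ℚ.≤-reflexive (ℚ.*-identityʳ x)) x≤1)
  ... | inj₂ x≤0 = subst (_≤ 1ℚ) (solve 1 (λ x → (:- x) :* (:- x) := x :* x) refl x)
                     (ℚ.≤-trans (*-monoˡ-≤-nonNeg (ℚ.neg-antimono-≤ x≤0) -x≤1) (ℚ.≤-trans (ℚ.≤-reflexive (ℚ.*-identityʳ (- x))) -x≤1))
    where
      -x≤1 : - x ≤ 1ℚ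
      -x≤1 = ℚ.neg-antimono-≤ -1≤x

  sumFin-nonNeg : ∀ d (f : Fin d → ℚ) → (∀ i → 0ℚ ≤ f i) → 0ℚ ≤ sumFin d f
  sumFin-nonNeg zero    f _     = ℚ.≤-refl
  sumFin-nonNeg (suc d) f 0≤f = ℚ.+-mono-≤ (0≤f zero) (sumFin-nonNeg d (λ i → f (suc i)) (λ i → 0≤f (suc i)))

  *-sumFin≤ : ∀ d (f : Fin d → ℚ) {K} → 0ℚ ≤ K → (∀ i → K * f i ≤ 1ℚ) → K * sumFin d f ≤ ⟦ d ⟧
  *-sumFin≤ zero    f {K} _   _      = ℚ.≤-reflexive (ℚ.*-zeroʳ K)
  *-sumFin≤ (suc d) f {K} 0≤K Kf≤1 = begin
    K * (f zero + sumFin d (λ i → f (suc i)))         ≡⟨ ℚ.*-distribˡ-+ K (f zero) _ ⟩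
    K * f zero + K * sumFin d (λ i → f (suc i))       ≤⟨ ℚ.+-mono-≤ (Kf≤1 zero) (*-sumFin≤ d (λ i → f (suc i)) 0≤K (λ i → Kf≤1 (suc i))) ⟩
    1ℚ + ⟦ d ⟧                                        ≡⟨ ℕtoℚ-+ 1 d ⟨
    ⟦ suc d ⟧                                         ∎
    where open ℚ.≤-Reasoning

  powℚ-nonNeg : ∀ {x} n → 0ℚ ≤ x → 0ℚ ≤ powℚ x n
  powℚ-nonNeg zero    _   = ℚ.<⇒≤ (ℚ.positive⁻¹ 1ℚ)
  powℚ-nonNeg (suc n) 0≤x = 0≤x*y 0≤x (powℚ-nonNeg n 0≤x)

  powℚ-mono-≤ : ∀ {x y} n → 0ℚ ≤ x → x ≤ y → powℚ x n ≤ powℚ y n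
  powℚ-mono-≤ zero    _   _   = ℚ.≤-refl
  powℚ-mono-≤ (suc n) 0≤x x≤y = ℚ.≤-trans (*-monoʳ-≤-nonNeg (powℚ-nonNeg n 0≤x) x≤y)
                                          (*-monoˡ-≤-nonNeg (ℚ.≤-trans 0≤x x≤y) (powℚ-mono-≤ n 0≤x x≤y))

  powℚ-* : ∀ x y n → powℚ (x * y) n ≡ powℚ x n * powℚ y n
  powℚ-* x y zero    = refl
  powℚ-* x y (suc n) = trans (cong ((x * y) *_) (powℚ-* x y n))
    (solve 4 (λ x y a b → (x :* y) :* (a :* b) := (x :* a) :* (y :* b)) refl x y (powℚ x n) (powℚ y n))

  powℚ-ℕtoℚ : ∀ a n → powℚ ⟦ a ⟧ n ≡ ⟦ a ℕ.^ n ⟧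
  powℚ-ℕtoℚ a zero    = refl
  powℚ-ℕtoℚ a (suc n) = trans (cong (⟦ a ⟧ *_) (powℚ-ℕtoℚ a n)) (sym (ℕtoℚ-* a (a ℕ.^ n)))

  dist²-nonNeg : ∀ {d} (x y : Fin d → ℚ) → 0ℚ ≤ dist² x y
  dist²-nonNeg {d} x y = sumFin-nonNeg d _ λ ℓ → subst (0ℚ ≤_) (cong ((x ℓ - y ℓ) *_) (sym (ℚ.*-identityʳ (x ℓ - y ℓ)))) (0≤x*x (x ℓ - y ℓ))

module NatBounds where

  open import Data.Nat
  open import Data.Nat.Properties
  open import Data.Fin as Fin using (Fin)
  open import Data.Product using (Σ; _×_; _,_)
  open import Relation.Nullary using (¬_; yes; no)
  open import Relation.Nullary.Negation using (contradiction)
  open import Relation.Unary using (Pred; Decidable)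
  open import Relation.Binary.PropositionalEquality
  open import Algebra.Definitions.RawMonoid +-0-rawMonoid using () renaming (sum to Σℕ)
  open import Algebra.Definitions.RawMonoid *-1-rawMonoid using () renaming (sum to ∏ℕ)
  open import Data.Nat.Solver using (module +-*-Solver)

  crossing : ∀ {ℓ} {P : Pred ℕ ℓ} → Decidable P → P 0 → ∀ n → ¬ P n → Σ ℕ λ k → P k × ¬ P (suc k)
  crossing P? P0 zero    ¬P0 = contradiction P0 ¬P0
  crossing P? P0 (suc n) ¬P[1+n] with P? n
  ... | yes Pn = n , Pn , ¬P[1+n]
  ... | no ¬Pn = crossing P? P0 n ¬Pn

  n<q^n : ∀ {q} → 1 < q → ∀ n → n < q ^ n
  n<q^n 1<q zero    = s≤s z≤n
  n<q^n {q} 1<q (suc n) = begin-strict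
    suc n          ≤⟨ n<q^n 1<q n ⟩
    q ^ n          <⟨ m<m*n (q ^ n) q 1<q ⟩
    q ^ n * q      ≡⟨ *-comm (q ^ n) q ⟩
    q * q ^ n      ∎
    where
      open ≤-Reasoning
      instance _ = m^n≢0 q n {{>-nonZero (<-trans z<s 1<q)}}

  exists-scale : ∀ {q d N} → 1 < q → 1 ≤ d → 1 ≤ N → Σ ℕ λ k → (q ^ k) ^ d ≤ N × N < (q ^ suc k) ^ d
  exists-scale {q} {d} {N} 1<q 1≤d 1≤N with crossing (λ k → (q ^ k) ^ d ≤? N) (subst (_≤ N) (sym (^-zeroˡ d)) 1≤N) N ¬[q^N]^d≤N
    where
      instance _ = >-nonZero (<-trans z<s 1<q)
      ¬[q^N]^d≤N : ¬ (q ^ N) ^ d ≤ N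
      ¬[q^N]^d≤N = <⇒≱ (<-≤-trans (n<q^n 1<q N) (subst (_≤ (q ^ N) ^ d) (^-identityʳ (q ^ N))
                                                  (^-monoʳ-≤ (q ^ N) {{m^n≢0 q N}} 1≤d)))
  ... | k , [q^k]^d≤N , ¬[q^1+k]^d≤N = k , [q^k]^d≤N , ≰⇒> ¬[q^1+k]^d≤N

  p^e-scale : ∀ {p e d N} → 1 < p → 1 ≤ e → 1 ≤ d → 1 ≤ N →
              Σ ℕ λ k → (p ^ (e * k)) ^ d ≤ N × N < (p ^ e * p ^ (e * k)) ^ d
  p^e-scale {p} {e} {d} {N} 1<p 1≤e 1≤d 1≤N with exists-scale {p ^ e} 1<p^e 1≤d 1≤N
    where
      instance _ = >-nonZero (<-trans z<s 1<p)
      1<p^e : 1 < p ^ e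
      1<p^e = <-≤-trans 1<p (subst (_≤ p ^ e) (^-identityʳ p) (^-monoʳ-≤ p 1≤e))
  ... | k , [q^k]^d≤N , N<[q^1+k]^d =
    k , subst (λ Q → Q ^ d ≤ N) (^-*-assoc p e k) [q^k]^d≤N , subst (λ Q → N < (p ^ e * Q) ^ d) (^-*-assoc p e k) N<[q^1+k]^d

  [m*n]^o≡m^o*n^o : ∀ m n o → (m * n) ^ o ≡ m ^ o * n ^ o
  [m*n]^o≡m^o*n^o m n zero    = refl
  [m*n]^o≡m^o*n^o m n (suc o) = trans (cong (m * n *_) ([m*n]^o≡m^o*n^o m n o))
    (solve 4 (λ m n x y → (m :* n) :* (x :* y) := (m :* x) :* (n :* y)) refl m n (m ^ o) (n ^ o))
    where open +-*-Solver

  ^-Σ : ∀ p {d} (f : Fin d → ℕ) → p ^ Σℕ f ≡ ∏ℕ (λ i → p ^ f i)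
  ^-Σ p {zero}  f = refl
  ^-Σ p {suc d} f = trans (^-distribˡ-+-* p (f Fin.zero) _) (cong (p ^ f Fin.zero *_) (^-Σ p (λ i → f (Fin.suc i))))

  ∏^≤^ : ∀ {D N m} (f : Fin m → ℕ) → (∀ i → f i ^ D ≤ N) → ∏ℕ f ^ D ≤ N ^ m
  ∏^≤^ {D} {N} {zero}  f _       = ≤-reflexive (^-zeroˡ D)
  ∏^≤^ {D} {N} {suc m} f f^D≤N = ≤-trans (≤-reflexive ([m*n]^o≡m^o*n^o (f Fin.zero) _ D))
    (*-mono-≤ (f^D≤N Fin.zero) (∏^≤^ {D} {N} (λ i → f (Fin.suc i)) (λ i → f^D≤N (Fin.suc i))))

  ^-cancelʳ-≤ : ∀ d {a b} → 1 ≤ d → a ^ d ≤ b ^ d → a ≤ b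
  ^-cancelʳ-≤ d {a} {b} 1≤d a^d≤b^d with a ≤? b
  ... | yes a≤b = a≤b
  ... | no  a≰b = contradiction a^d≤b^d (<⇒≱ (^-monoˡ-< d {{>-nonZero 1≤d}} (≰⇒> a≰b)))

  argmin : ∀ {d} (f : Fin (suc d) → ℕ) → Σ (Fin (suc d)) λ i → ∀ j → f i ≤ f j
  argmin {zero}  f = Fin.zero , λ { Fin.zero → ≤-refl }
  argmin {suc d} f with argmin (λ i → f (Fin.suc i))
  ... | i , fᵢ≤ with f Fin.zero ≤? f (Fin.suc i)
  ...   | yes f₀≤fᵢ = Fin.zero , λ { Fin.zero → ≤-refl ; (Fin.suc j) → ≤-trans f₀≤fᵢ (fᵢ≤ j) }
  ...   | no  f₀≰fᵢ = Fin.suc i , λ { Fin.zero → <⇒≤ (≰⇒> f₀≰fᵢ) ; (Fin.suc j) → fᵢ≤ j }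

  ≤-maxFin : ∀ {d} (f : Fin d → ℕ) i → f i ≤ maxFin d f
  ≤-maxFin {suc d} f Fin.zero    = m≤m⊔n _ _
  ≤-maxFin {suc d} f (Fin.suc i) = ≤-trans (≤-maxFin (λ j → f (Fin.suc j)) i) (m≤n⊔m _ _)

  ∏ℕ-≤ : ∀ {d N} → 1 ≤ d → (f : Fin d → ℕ) → (∀ i → f i ^ d ≤ N) → ∏ℕ f ≤ N
  ∏ℕ-≤ {d} {N} 1≤d f fᵢ^d≤N = ^-cancelʳ-≤ d 1≤d (∏^≤^ {d} {N} f fᵢ^d≤N)

module RadicalInverse (p : ℕ) .{{_ : NonZero p}} (pr : Prime p) (b : Poly) (wf : WellFormed p b) (e≥1 : 1 ℕ.≤ deg b) where

  open import Data.Nat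
  open import Data.Nat.Properties
  open import Data.Nat.DivMod
  open import Data.List using (List; []; _∷_; length)
  open import Data.List.Relation.Unary.All using (All; []; _∷_)
  open import Data.Product using (_×_; _,_; proj₁; proj₂)
  open import Relation.Binary.PropositionalEquality
  open PolyRing p
  open Division p b
  open DivisionAlgorithm p pr b wf
  open EvalAtP p (FermatLittle.prime>1 pr)

  Z : ℕ → ℕ
  Z j = p ^ (e * j)

  instance
    Z≢0 : ∀ {j} → NonZero (Z j)
    Z≢0 {j} = m^n≢0 p (e * j)

  Z-suc : ∀ j → Z (suc j) ≡ p ^ e * Z j
  Z-suc j = trans (cong (p ^_) (*-suc e j)) (^-distribˡ-+-* p e (e * j))

  Z-+ : ∀ m n → Z (m + n) ≡ Z m * Z n
  Z-+ m n = trans (cong (p ^_) (*-distribˡ-+ e m n)) (^-distribˡ-+-* p (e * m) (e * n))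

  -- The polynomial whose k leading b(X)-adic digits are the base p^e digits of c (most significant first).
  lift : ℕ → ℕ → Poly
  lift zero    c = []
  lift (suc k) c = digitPoly p e (c / Z k) ⊕ b ⊗ lift k (c % Z k)

  leadingValue : ℕ → List Poly → ℕ
  leadingValue zero    _        = 0
  leadingValue (suc k) []       = 0
  leadingValue (suc k) (a ∷ as) = evalAtP p a * Z k + leadingValue k as

  first-digit : ∀ k c {w r q} → c < Z (suc k) → length r ≤ e →
                q ⊗ b ⊕ r ≈ lift (suc k) c ⊕ b ^ᵖ suc k ⊗ w →
                evalAtP p r ≡ c / Z k × q ≈ lift k (c % Z k) ⊕ b ^ᵖ k ⊗ w
  first-digit k c {w} {r} {q} c<Z r<b qb+r≈ = evr≡ , proj₂ unique
    where
      d L : Poly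
      d = digitPoly p e (c / Z k)
      L = lift k (c % Z k)
      unique : r ≈ d × q ≈ L ⊕ b ^ᵖ k ⊗ w
      unique = division-unique r<b (≤-reflexive (length-digitPoly e (c / Z k))) (begin
        r ⊕ b ⊗ q                          ≈⟨ 𝔽ₚ[X].trans (𝔽ₚ[X].+-comm r (b ⊗ q)) (⊕-congʳ (𝔽ₚ[X].*-comm b q)) ⟩
        q ⊗ b ⊕ r                          ≈⟨ qb+r≈ ⟩
        (d ⊕ b ⊗ L) ⊕ b ⊗ b ^ᵖ k ⊗ w       ≈⟨ solve-𝔽ₚ[X] 5 (λ d b L B w → ((d :+ b :* L) :+ (b :* B) :* w) ⊜ (d :+ b :* (L :+ B :* w)))
                                                 𝔽ₚ[X].refl d b L (b ^ᵖ k) w ⟩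
        d ⊕ b ⊗ (L ⊕ b ^ᵖ k ⊗ w)           ∎)
        where open ≈-Reasoning
      evr≡ : evalAtP p r ≡ c / Z k
      evr≡ = trans (evalAtP-cong (proj₁ unique))
                   (evalAtP-digitPoly e (m<n*o⇒m/o<n (subst (c <_) (Z-suc k) c<Z)))

  leadingValue-[] : ∀ k → leadingValue k [] ≡ 0
  leadingValue-[] zero    = refl
  leadingValue-[] (suc k) = refl

  private
    split-c : ∀ k c {v u} → v ≡ c / Z k → u ≡ c % Z k → v * Z k + u ≡ c
    split-c k c refl refl = trans (+-comm (c / Z k * Z k) (c % Z k)) (sym (m≡m%n+[m/n]*n c (Z k)))

  -- Fuel 0 forces f = [], whose digits are the empty list; the same first-digit argument then shows c = 0.
  leadingValue-adicDigits : ∀ k fuel f c {w} → length f ≤ fuel → c < Z k → f ≈ lift k c ⊕ b ^ᵖ k ⊗ w →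
                            leadingValue k (adicDigits fuel f) ≡ c
  leadingValue-adicDigits zero    fuel       f  c         _      c<Z _ = sym (n<1⇒n≡0 (subst (c <_) (cong (p ^_) (*-zeroʳ e)) c<Z))
  leadingValue-adicDigits (suc k) zero       [] c {w} _    c<Z f≈ =
    trans (sym (leadingValue-[] k))
          (split-c k c (proj₁ digit) (leadingValue-adicDigits k zero [] (c % Z k) z≤n (m%n<n c (Z k)) (proj₂ digit)))
    where
      digit : evalAtP p [] ≡ c / Z k × [] ≈ lift k (c % Z k) ⊕ b ^ᵖ k ⊗ w
      digit = first-digit k c c<Z z≤n f≈
  leadingValue-adicDigits (suc k) (suc fuel) f  c {w} |f|≤ c<Z f≈
    with divmodP f | divmodP-correct f | divmodP-length-r f | divmodP-length-q f
  ... | q , r | f≈qb+r | |r|≤e | |q|≤ =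
    split-c k c (proj₁ digit) (leadingValue-adicDigits k fuel q (c % Z k) |q|≤fuel (m%n<n c (Z k)) (proj₂ digit))
    where
      digit : evalAtP p r ≡ c / Z k × q ≈ lift k (c % Z k) ⊕ b ^ᵖ k ⊗ w
      digit = first-digit k c c<Z |r|≤e (𝔽ₚ[X].trans (𝔽ₚ[X].sym f≈qb+r) f≈)
      |q|≤fuel : length q ≤ fuel
      |q|≤fuel = ≤-trans |q|≤ (≤-trans (∸-monoʳ-≤ (length f) e≥1) (∸-monoˡ-≤ 1 |f|≤))

  DigitsBelow : List Poly → Set
  DigitsBelow = All (λ a → evalAtP p a < p ^ e)

  adicDigits-below : ∀ fuel f → DigitsBelow (adicDigits fuel f)
  adicDigits-below zero       f = []
  adicDigits-below (suc fuel) f with divmodP f | divmodP-length-r f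
  ... | q , r | |r|≤e = <-≤-trans (evalAtP<p^length r) (^-monoʳ-≤ p |r|≤e) ∷ adicDigits-below fuel q

module RadicalInverseBounds (p : ℕ) .{{_ : NonZero p}} (pr : Prime p) (b : Poly) (wf : WellFormed p b) (e≥1 : 1 ℕ.≤ deg b) where

  open import Data.Nat using (zero; suc)
  import Data.Nat.Properties as ℕₚ
  open import Data.List using (List; []; _∷_; length)
  open import Data.List.Relation.Unary.All using ([]; _∷_)
  open import Data.Product using (_×_; _,_; proj₁; proj₂)
  open import Relation.Binary.PropositionalEquality
  open import Data.Integer using (+_)
  open import Data.Rational as ℚ using (ℚ; 0ℚ; 1ℚ; _+_; _*_; _≤_; _/_)
  import Data.Rational.Properties as ℚ
  open import Data.Rational.Solver using (module +-*-Solver)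
  open NatToRational
  open RationalFacts using (0≤x*y)
  open Division p b
  open PolyRing p using (_≈_; _⊕_; _⊗_; _^ᵖ_)
  open RadicalInverse p pr b wf e≥1

  head-term : ∀ j a → ⟦ Z (suc j) ⟧ * ((+ a) / Z (suc j)) ≡ ⟦ a ⟧
  head-term j a = ℕtoℚ*/≡ (Z (suc j)) a

  radSum-bounded : ∀ j as → DigitsBelow as → 0ℚ ≤ radSum j as × ⟦ Z j ⟧ * radSum j as ≤ 1ℚ
  radSum-bounded j []       []           = ℚ.≤-refl , ℚ.≤-trans (ℚ.≤-reflexive (ℚ.*-zeroʳ ⟦ Z j ⟧)) (ℚ.<⇒≤ (ℚ.positive⁻¹ 1ℚ))
  radSum-bounded j (a ∷ as) (a<q ∷ as<q) = ℚ.+-mono-≤ (/-nonNeg (evalAtP p a) (Z (suc j))) (proj₁ IH) , ≤1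
    where
      open ℚ.≤-Reasoning
      A R′ : ℚ
      A = (+ evalAtP p a) / Z (suc j)
      R′ = radSum (suc j) as
      IH : 0ℚ ≤ R′ × ⟦ Z (suc j) ⟧ * R′ ≤ 1ℚ
      IH = radSum-bounded (suc j) as as<q
      q : ℕ
      q = p ℕ.^ e
      instance _ = ℕₚ.m^n≢0 p e
      ≤1 : ⟦ Z j ⟧ * (A + R′) ≤ 1ℚ
      ≤1 = ℚ.*-cancelˡ-≤-pos ⟦ q ⟧ {{ℕtoℚ-pos q}} (begin
        ⟦ q ⟧ * (⟦ Z j ⟧ * (A + R′))               ≡⟨ ℚ.*-assoc ⟦ q ⟧ ⟦ Z j ⟧ (A + R′) ⟨
        ⟦ q ⟧ * ⟦ Z j ⟧ * (A + R′)                 ≡⟨ cong (_* (A + R′)) (trans (sym (ℕtoℚ-* q (Z j))) (cong ⟦_⟧ (sym (Z-suc j)))) ⟩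
        ⟦ Z (suc j) ⟧ * (A + R′)                   ≡⟨ ℚ.*-distribˡ-+ ⟦ Z (suc j) ⟧ A R′ ⟩
        ⟦ Z (suc j) ⟧ * A + ⟦ Z (suc j) ⟧ * R′     ≡⟨ cong (_+ ⟦ Z (suc j) ⟧ * R′) (head-term j (evalAtP p a)) ⟩
        ⟦ evalAtP p a ⟧ + ⟦ Z (suc j) ⟧ * R′       ≤⟨ ℚ.+-monoʳ-≤ ⟦ evalAtP p a ⟧ (proj₂ IH) ⟩
        ⟦ evalAtP p a ⟧ + 1ℚ                       ≡⟨ trans (ℚ.+-comm ⟦ evalAtP p a ⟧ 1ℚ) (sym (ℕtoℚ-+ 1 (evalAtP p a))) ⟩
        ⟦ suc (evalAtP p a) ⟧                      ≤⟨ ℕtoℚ-mono-≤ a<q ⟩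
        ⟦ q ⟧                                      ≡⟨ ℚ.*-identityʳ ⟦ q ⟧ ⟨
        ⟦ q ⟧ * 1ℚ                                 ∎)

  ⟦Z[m+n]⟧ : ∀ m n → ⟦ Z (m ℕ.+ n) ⟧ ≡ ⟦ Z m ⟧ * ⟦ Z n ⟧
  ⟦Z[m+n]⟧ m n = trans (cong ⟦_⟧ (Z-+ m n)) (ℕtoℚ-* (Z m) (Z n))

  Z*radSum-∷ : ∀ k j a as → ⟦ Z (j ℕ.+ suc k) ⟧ * radSum j (a ∷ as) ≡ ⟦ evalAtP p a ℕ.* Z k ⟧ + ⟦ Z (suc j ℕ.+ k) ⟧ * radSum (suc j) as
  Z*radSum-∷ k j a as = begin
    ⟦ Z (j ℕ.+ suc k) ⟧ * (A + R′)                              ≡⟨ cong (λ n → ⟦ Z n ⟧ * (A + R′)) (ℕₚ.+-suc j k) ⟩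
    ⟦ Z (suc j ℕ.+ k) ⟧ * (A + R′)                              ≡⟨ cong (_* (A + R′)) (⟦Z[m+n]⟧ (suc j) k) ⟩
    ⟦ Z (suc j) ⟧ * ⟦ Z k ⟧ * (A + R′)                          ≡⟨ solve 4 (λ β α A R → (β :* α) :* (A :+ R) := α :* (β :* A) :+ (β :* α) :* R)
                                                                          refl ⟦ Z (suc j) ⟧ ⟦ Z k ⟧ A R′ ⟩
    ⟦ Z k ⟧ * (⟦ Z (suc j) ⟧ * A) + ⟦ Z (suc j) ⟧ * ⟦ Z k ⟧ * R′ ≡⟨ cong₂ _+_ (cong (⟦ Z k ⟧ *_) (head-term j (evalAtP p a)))
                                                                            (cong (_* R′) (sym (⟦Z[m+n]⟧ (suc j) k))) ⟩
    ⟦ Z k ⟧ * ⟦ evalAtP p a ⟧ + ⟦ Z (suc j ℕ.+ k) ⟧ * R′         ≡⟨ cong (_+ ⟦ Z (suc j ℕ.+ k) ⟧ * R′)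
                                                                         (trans (ℚ.*-comm ⟦ Z k ⟧ _) (sym (ℕtoℚ-* (evalAtP p a) (Z k)))) ⟩
    ⟦ evalAtP p a ℕ.* Z k ⟧ + ⟦ Z (suc j ℕ.+ k) ⟧ * R′           ∎
    where
      open ≡-Reasoning
      open +-*-Solver using (solve; _:+_; _:*_; _:=_)
      A R′ : ℚ
      A = (+ evalAtP p a) / Z (suc j)
      R′ = radSum (suc j) as

  -- Scaling by Z (j + k) turns the first k digits into the integer leadingValue k and leaves a tail in [0, 1].
  radSum-leadingValue : ∀ k j as → DigitsBelow as →
                        ⟦ leadingValue k as ⟧ ≤ ⟦ Z (j ℕ.+ k) ⟧ * radSum j as × ⟦ Z (j ℕ.+ k) ⟧ * radSum j as ≤ ⟦ leadingValue k as ⟧ + 1ℚ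
  radSum-leadingValue zero j as as<q = subst (λ n → 0ℚ ≤ ⟦ Z n ⟧ * radSum j as × ⟦ Z n ⟧ * radSum j as ≤ 0ℚ + 1ℚ) (sym (ℕₚ.+-identityʳ j))
    (0≤x*y (ℕtoℚ-nonNeg (Z j)) (proj₁ bounded) , ℚ.≤-trans (proj₂ bounded) (ℚ.≤-reflexive (sym (ℚ.+-identityˡ 1ℚ))))
    where
      bounded : 0ℚ ≤ radSum j as × ⟦ Z j ⟧ * radSum j as ≤ 1ℚ
      bounded = radSum-bounded j as as<q
  radSum-leadingValue (suc k) j []       []           =
    ℚ.≤-reflexive (sym (ℚ.*-zeroʳ ⟦ Z (j ℕ.+ suc k) ⟧)) ,
    ℚ.≤-trans (ℚ.≤-reflexive (ℚ.*-zeroʳ ⟦ Z (j ℕ.+ suc k) ⟧)) (ℚ.<⇒≤ (ℚ.positive⁻¹ (0ℚ + 1ℚ)))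
  radSum-leadingValue (suc k) j (a ∷ as) (a<q ∷ as<q) = lower , upper
    where
      E : ℚ
      E = ⟦ evalAtP p a ℕ.* Z k ⟧
      IH : ⟦ leadingValue k as ⟧ ≤ ⟦ Z (suc j ℕ.+ k) ⟧ * radSum (suc j) as × ⟦ Z (suc j ℕ.+ k) ⟧ * radSum (suc j) as ≤ ⟦ leadingValue k as ⟧ + 1ℚ
      IH = radSum-leadingValue k (suc j) as as<q
      lower : ⟦ evalAtP p a ℕ.* Z k ℕ.+ leadingValue k as ⟧ ≤ ⟦ Z (j ℕ.+ suc k) ⟧ * radSum j (a ∷ as)
      lower = begin
        ⟦ evalAtP p a ℕ.* Z k ℕ.+ leadingValue k as ⟧  ≡⟨ ℕtoℚ-+ (evalAtP p a ℕ.* Z k) (leadingValue k as) ⟩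
        E + ⟦ leadingValue k as ⟧                      ≤⟨ ℚ.+-monoʳ-≤ E (proj₁ IH) ⟩
        E + ⟦ Z (suc j ℕ.+ k) ⟧ * radSum (suc j) as    ≡⟨ Z*radSum-∷ k j a as ⟨
        ⟦ Z (j ℕ.+ suc k) ⟧ * radSum j (a ∷ as)        ∎
        where open ℚ.≤-Reasoning
      upper : ⟦ Z (j ℕ.+ suc k) ⟧ * radSum j (a ∷ as) ≤ ⟦ evalAtP p a ℕ.* Z k ℕ.+ leadingValue k as ⟧ + 1ℚ
      upper = begin
        ⟦ Z (j ℕ.+ suc k) ⟧ * radSum j (a ∷ as)        ≡⟨ Z*radSum-∷ k j a as ⟩
        E + ⟦ Z (suc j ℕ.+ k) ⟧ * radSum (suc j) as    ≤⟨ ℚ.+-monoʳ-≤ E (proj₂ IH) ⟩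
        E + (⟦ leadingValue k as ⟧ + 1ℚ)               ≡⟨ ℚ.+-assoc E _ 1ℚ ⟨
        E + ⟦ leadingValue k as ⟧ + 1ℚ                 ≡⟨ cong (_+ 1ℚ) (ℕtoℚ-+ (evalAtP p a ℕ.* Z k) (leadingValue k as)) ⟨
        ⟦ evalAtP p a ℕ.* Z k ℕ.+ leadingValue k as ⟧ + 1ℚ ∎
        where open ℚ.≤-Reasoning

  radInv-in-cell : ∀ k c n {w} → c ℕ.< Z k → nPoly p n ≈ lift k c ⊕ b ^ᵖ k ⊗ w → InCell c (Z k) (radInv n)
  radInv-in-cell k c n c<Z n≈ = subst (λ v → InCell v (Z k) (radInv n))
    (leadingValue-adicDigits k (length (nPoly p n)) (nPoly p n) c ℕₚ.≤-refl c<Z n≈)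
    (radSum-leadingValue k 0 (adicDigits (length (nPoly p n)) (nPoly p n)) (adicDigits-below _ (nPoly p n)))

module HaltonBox (p : ℕ) .{{_ : NonZero p}} (pr : Prime p) where

  open import Data.Nat using (_<_; _≤_; _^_; _*_)
  open import Data.Nat.Properties using (<-≤-trans; ≤-trans; ≤-reflexive; ^-monoʳ-≤; *-comm)
  open import Data.Fin using (Fin)
  open import Data.Product using (Σ; _×_; _,_; proj₁; proj₂)
  open import Relation.Binary.PropositionalEquality using (_≢_; subst)
  open import Data.List using (length)
  open import Algebra.Definitions.RawMonoid ℕ.+-0-rawMonoid using () renaming (sum to Σℕ)
  open import Algebra.Definitions.RawMonoid ℕ.*-1-rawMonoid using () renaming (sum to ∏ℕ)
  open PolyRing p
  open Bezout p pr
  open ChineseRemainder p pr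
  open EvalAtP p (FermatLittle.prime>1 pr)
  open NatToRational

  -- n(X) is the CRT solution of n(X) ≡ lift_ℓ(c_ℓ) mod b_ℓ(X)^k_ℓ.
  halton-hits-box : ∀ {d} (b : Fin d → Poly) (wf : ∀ ℓ → WellFormed p (b ℓ)) (e≥1 : ∀ ℓ → 1 ≤ deg (b ℓ)) →
    (∀ i j → i ≢ j → RelPrime p (b i) (b j)) →
    (k c : Fin d → ℕ) → (∀ ℓ → c ℓ < p ^ (deg (b ℓ) * k ℓ)) →
    Σ ℕ λ n → n < ∏ℕ (λ ℓ → p ^ (deg (b ℓ) * k ℓ)) ×
      ∀ ℓ → InCell (c ℓ) (p ^ (deg (b ℓ) * k ℓ)) (halton p b n ℓ)
  halton-hits-box b wf e≥1 b⊥b k c c<Q = evalAtP p F , n<∏Q , in-box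
    where
      module R (ℓ : Fin _) = RadicalInverse p pr (b ℓ) (wf ℓ) (e≥1 ℓ)
      module RB (ℓ : Fin _) = RadicalInverseBounds p pr (b ℓ) (wf ℓ) (e≥1 ℓ)
      module D (ℓ : Fin _) = DivisionAlgorithm p pr (b ℓ) (wf ℓ)
      M T : Fin _ → Poly
      M ℓ = b ℓ ^ᵖ k ℓ
      T ℓ = R.lift ℓ (k ℓ) (c ℓ)
      deg-b : ∀ ℓ → HasDegree (b ℓ) (deg (b ℓ))
      deg-b ℓ = hasDegree (D.length-b ℓ) (D.lc%p≢0 ℓ)
      M⊥M : ∀ i j → i ≢ j → Comaximal (M i) (M j)
      M⊥M i j i≢j = comaximal-sym (comaximal-^ (k i) (comaximal-sym (comaximal-^ (k j)
                      (relPrime⇒comaximal (b i) (b j) (HasDegree⇒≉[] (deg-b i)) (b⊥b i j i≢j)))))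
      deg-M : ∀ ℓ → HasDegree (M ℓ) (deg (b ℓ) * k ℓ)
      deg-M ℓ = subst (HasDegree (M ℓ)) (*-comm (k ℓ) (deg (b ℓ))) (HasDegree-^ (k ℓ) (deg-b ℓ))
      solution : Σ Poly λ F → length F ≤ Σℕ (λ ℓ → deg (b ℓ) * k ℓ) × ∀ ℓ → F ≈ T ℓ mod M ℓ
      solution = crt M T (λ ℓ → deg (b ℓ) * k ℓ) deg-M M⊥M
      F : Poly
      F = proj₁ solution
      n<∏Q : evalAtP p F < ∏ℕ (λ ℓ → p ^ (deg (b ℓ) * k ℓ))
      n<∏Q = <-≤-trans (evalAtP<p^length F) (≤-trans (^-monoʳ-≤ p (proj₁ (proj₂ solution)))
               (≤-reflexive (NatBounds.^-Σ p (λ ℓ → deg (b ℓ) * k ℓ))))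
      in-box : ∀ ℓ → InCell (c ℓ) (p ^ (deg (b ℓ) * k ℓ)) (halton p b (evalAtP p F) ℓ)
      in-box ℓ = RB.radInv-in-cell ℓ (k ℓ) (c ℓ) (evalAtP p F) (c<Q ℓ)
                   (𝔽ₚ[X].trans (nPoly-evalAtP F) (_≈_mod_.≈+multiple (proj₂ (proj₂ solution) ℓ)))

module CellGeometry where

  open import Data.Nat as ℕ using (ℕ; zero; suc)
  import Data.Nat.Properties as ℕ
  open import Data.Rational as ℚ using (ℚ; 0ℚ; 1ℚ; _≤_; _+_; _*_; _-_; -_)
  import Data.Rational.Properties as ℚ
  open import Data.Rational.Solver using (module +-*-Solver)
  open import Data.Product using (Σ; _×_; _,_)
  open import Relation.Nullary using (yes; no)
  open import Relation.Binary.PropositionalEquality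
  open +-*-Solver using (solve; _:+_; _:*_; _:-_; :-_; _:=_; con)
  open NatToRational
  open RationalFacts
  open NatBounds using ([m*n]^o≡m^o*n^o)
  open import Data.Nat.Solver using () renaming (module +-*-Solver to ℕ+*Solver)

  cell-index : ∀ Q {x} → 1 ℕ.≤ Q → 0ℚ ≤ x → x ≤ 1ℚ → Σ ℕ λ c → c ℕ.< Q × InCell c Q x
  cell-index Q {x} 1≤Q 0≤x x≤1 = search (Q ℕ.∸ 1) (ℕ.∸-monoʳ-< ℕ.z<s 1≤Q) Qx≤Q
    where
      Qx : ℚ
      Qx = ⟦ Q ⟧ * x
      search : ∀ c → c ℕ.< Q → Qx ≤ ⟦ c ⟧ + 1ℚ → Σ ℕ λ c → c ℕ.< Q × InCell c Q x
      search zero    0<Q Qx≤1   = 0 , 0<Q , 0≤x*y (ℕtoℚ-nonNeg Q) 0≤x , Qx≤1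
      search (suc c) c+1<Q Qx≤c+2 with Qx ℚ.≤? ⟦ c ⟧ + 1ℚ
      ... | yes Qx≤c+1 = search c (ℕ.<-trans (ℕ.n<1+n c) c+1<Q) Qx≤c+1
      ... | no  Qx≰c+1 = suc c , c+1<Q , ℚ.≤-trans (ℚ.≤-reflexive (trans (ℕtoℚ-+ 1 c) (ℚ.+-comm 1ℚ ⟦ c ⟧))) (ℚ.<⇒≤ (ℚ.≰⇒> Qx≰c+1)) , Qx≤c+2
      Qx≤Q : Qx ≤ ⟦ Q ℕ.∸ 1 ⟧ + 1ℚ
      Qx≤Q = ℚ.≤-trans (*-monoˡ-≤-nonNeg (ℕtoℚ-nonNeg Q) x≤1)
               (ℚ.≤-reflexive (trans (ℚ.*-identityʳ ⟦ Q ⟧) (trans (cong ⟦_⟧ (sym (ℕ.m∸n+n≡m 1≤Q))) (ℕtoℚ-+ (Q ℕ.∸ 1) 1))))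

  same-cell⇒close : ∀ {m Q x y} c → m ℕ.≤ Q → InCell c Q x → InCell c Q y → ⟦ m ℕ.* m ⟧ * powℚ (x - y) 2 ≤ 1ℚ
  same-cell⇒close {m} {Q} {x} {y} c m≤Q (c≤Qx , Qx≤c+1) (c≤Qy , Qy≤c+1) = begin
    ⟦ m ℕ.* m ⟧ * powℚ (x - y) 2                  ≤⟨ *-monoʳ-≤-nonNeg 0≤[x-y]² (ℕtoℚ-mono-≤ (ℕ.*-mono-≤ m≤Q m≤Q)) ⟩
    ⟦ Q ℕ.* Q ⟧ * powℚ (x - y) 2                  ≡⟨ cong (_* powℚ (x - y) 2) (ℕtoℚ-* Q Q) ⟩
    ⟦ Q ⟧ * ⟦ Q ⟧ * ((x - y) * ((x - y) * 1ℚ))    ≡⟨ solve 3 (λ Q x y → Q :* Q :* ((x :- y) :* ((x :- y) :* con 1ℚ))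
                                                                       := (Q :* x :- Q :* y) :* (Q :* x :- Q :* y)) refl ⟦ Q ⟧ x y ⟩
    t * t                                         ≤⟨ -1≤x≤1⇒x*x≤1 -1≤t t≤1 ⟩
    1ℚ                                            ∎
    where
      open ℚ.≤-Reasoning
      t : ℚ
      t = ⟦ Q ⟧ * x - ⟦ Q ⟧ * y
      0≤[x-y]² : 0ℚ ≤ powℚ (x - y) 2
      0≤[x-y]² = subst (0ℚ ≤_) (cong ((x - y) *_) (sym (ℚ.*-identityʳ (x - y)))) (0≤x*x (x - y))
      -1≤t : - 1ℚ ≤ t
      -1≤t = ℚ.≤-trans (ℚ.≤-reflexive (solve 1 (λ c → :- con 1ℚ := c :- (c :+ con 1ℚ)) refl ⟦ c ⟧))
                       (ℚ.+-mono-≤ c≤Qx (ℚ.neg-antimono-≤ Qy≤c+1))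
      t≤1 : t ≤ 1ℚ
      t≤1 = ℚ.≤-trans (ℚ.+-mono-≤ Qx≤c+1 (ℚ.neg-antimono-≤ c≤Qy))
                      (ℚ.≤-reflexive (solve 1 (λ c → (c :+ con 1ℚ) :- c := con 1ℚ) refl ⟦ c ⟧))

  N²≤M^[2d]*[m*m]^d : ∀ {N M m} d → N ℕ.≤ (M ℕ.* m) ℕ.^ d → N ℕ.* N ℕ.≤ M ℕ.^ (2 ℕ.* d) ℕ.* (m ℕ.* m) ℕ.^ d
  N²≤M^[2d]*[m*m]^d {N} {M} {m} d N≤[Mm]^d = ℕ.≤-trans (ℕ.*-mono-≤ N≤[Mm]^d N≤[Mm]^d) (ℕ.≤-reflexive (begin
    (M ℕ.* m) ℕ.^ d ℕ.* (M ℕ.* m) ℕ.^ d       ≡⟨ [m*n]^o≡m^o*n^o (M ℕ.* m) (M ℕ.* m) d ⟨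
    ((M ℕ.* m) ℕ.* (M ℕ.* m)) ℕ.^ d           ≡⟨ cong (ℕ._^ d) (ℕsolve 2 (λ M m → (M ℕ:* m) ℕ:* (M ℕ:* m) ℕ:= (M ℕ:* M) ℕ:* (m ℕ:* m)) refl M m) ⟩
    ((M ℕ.* M) ℕ.* (m ℕ.* m)) ℕ.^ d           ≡⟨ [m*n]^o≡m^o*n^o (M ℕ.* M) (m ℕ.* m) d ⟩
    (M ℕ.* M) ℕ.^ d ℕ.* (m ℕ.* m) ℕ.^ d       ≡⟨ cong (λ x → (M ℕ.* x) ℕ.^ d ℕ.* (m ℕ.* m) ℕ.^ d) (ℕ.*-identityʳ M) ⟨
    (M ℕ.^ 2) ℕ.^ d ℕ.* (m ℕ.* m) ℕ.^ d       ≡⟨ cong (ℕ._* (m ℕ.* m) ℕ.^ d) (ℕ.^-*-assoc M 2 d) ⟩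
    M ℕ.^ (2 ℕ.* d) ℕ.* (m ℕ.* m) ℕ.^ d       ∎))
    where
      open ≡-Reasoning
      open ℕ+*Solver using () renaming (solve to ℕsolve; _:*_ to _ℕ:*_; _:=_ to _ℕ:=_)

  covering-inequality : ∀ {D² d m M N} → 0ℚ ≤ D² → ⟦ m ℕ.* m ⟧ * D² ≤ ⟦ d ⟧ → N ℕ.≤ (M ℕ.* m) ℕ.^ d →
                        powℚ D² d * ⟦ N ℕ.* N ⟧ ≤ ⟦ d ℕ.^ d ℕ.* M ℕ.^ (2 ℕ.* d) ⟧
  covering-inequality {D²} {d} {m} {M} {N} 0≤D² m²D²≤d N≤[Mm]^d = begin
    powℚ D² d * ⟦ N ℕ.* N ⟧                       ≤⟨ *-monoˡ-≤-nonNeg (powℚ-nonNeg d 0≤D²) (ℕtoℚ-mono-≤ (N²≤M^[2d]*[m*m]^d d N≤[Mm]^d)) ⟩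
    powℚ D² d * ⟦ M^2d ℕ.* m²^d ⟧                 ≡⟨ cong (powℚ D² d *_) (ℕtoℚ-* M^2d m²^d) ⟩
    powℚ D² d * (⟦ M^2d ⟧ * ⟦ m²^d ⟧)             ≡⟨ solve 3 (λ a b c → a :* (b :* c) := b :* (c :* a)) refl (powℚ D² d) ⟦ M^2d ⟧ ⟦ m²^d ⟧ ⟩
    ⟦ M^2d ⟧ * (⟦ m²^d ⟧ * powℚ D² d)             ≡⟨ cong (λ z → ⟦ M^2d ⟧ * (z * powℚ D² d)) (powℚ-ℕtoℚ (m ℕ.* m) d) ⟨
    ⟦ M^2d ⟧ * (powℚ ⟦ m ℕ.* m ⟧ d * powℚ D² d)   ≡⟨ cong (⟦ M^2d ⟧ *_) (powℚ-* ⟦ m ℕ.* m ⟧ D² d) ⟨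
    ⟦ M^2d ⟧ * powℚ (⟦ m ℕ.* m ⟧ * D²) d          ≤⟨ *-monoˡ-≤-nonNeg (ℕtoℚ-nonNeg M^2d) (powℚ-mono-≤ d 0≤m²D² m²D²≤d) ⟩
    ⟦ M^2d ⟧ * powℚ ⟦ d ⟧ d                       ≡⟨ cong (⟦ M^2d ⟧ *_) (powℚ-ℕtoℚ d d) ⟩
    ⟦ M^2d ⟧ * ⟦ d ℕ.^ d ⟧                        ≡⟨ trans (ℚ.*-comm ⟦ M^2d ⟧ ⟦ d ℕ.^ d ⟧) (sym (ℕtoℚ-* (d ℕ.^ d) M^2d)) ⟩
    ⟦ d ℕ.^ d ℕ.* M^2d ⟧                          ∎
    where
      open ℚ.≤-Reasoning
      M^2d m²^d : ℕ
      M^2d = M ℕ.^ (2 ℕ.* d)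
      m²^d = (m ℕ.* m) ℕ.^ d
      0≤m²D² : 0ℚ ≤ ⟦ m ℕ.* m ⟧ * D²
      0≤m²D² = 0≤x*y (ℕtoℚ-nonNeg (m ℕ.* m)) 0≤D²


open import Data.Nat using (ℕ; NonZero; _≤_; _<_; _^_; _*_)
open import Data.Nat.Primality using (Prime)
open import Data.Fin using (Fin)
open import Data.Product using (Σ; _×_)
open import Relation.Binary.PropositionalEquality using (_≢_)
open import Data.Rational as ℚ using (ℚ; 0ℚ; 1ℚ)
open import Data.Nat using (suc)
open import Data.Nat.Properties using (<-≤-trans; ≤-trans; <⇒≤; ^-monoˡ-≤; *-monoˡ-≤; m^n>0)
open import Data.Product using (_,_; proj₁; proj₂)
open FermatLittle using (prime>1)
open NatToRational using (ℕtoℚ-nonNeg; InCell)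
open NatBounds using (argmin; ≤-maxFin; ∏ℕ-≤; p^e-scale)
open RationalFacts using (*-sumFin≤; dist²-nonNeg)
open CellGeometry using (cell-index; same-cell⇒close; covering-inequality)
open HaltonBox using (halton-hits-box)
open import Algebra.Definitions.RawMonoid Data.Nat.*-1-rawMonoid using () renaming (sum to ∏ℕ)

proposition3p5 : (p : ℕ) → .{{_ : NonZero p}} → Prime p →
    (d : ℕ) → 1 ≤ d →
    (b : Fin d → Poly) →
    (∀ ℓ → WellFormed p (b ℓ)) →
    (∀ ℓ → 1 ≤ deg (b ℓ)) →
    (∀ i j → i ≢ j → RelPrime p (b i) (b j)) →
    (N : ℕ) → 1 ≤ N →
    (x : Fin d → ℚ) → (∀ ℓ → (0ℚ ℚ.≤ x ℓ) × (x ℓ ℚ.≤ 1ℚ)) →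
    Σ ℕ λ n → (n < N) ×
      (ℚ._*_ (powℚ (dist² x (halton p b n)) d) (ℕtoℚ (N * N))
        ℚ.≤ ℕtoℚ ((d ^ d) * (maxFin d (λ ℓ → p ^ deg (b ℓ)) ^ (2 * d))))
proposition3p5 p pr d@(suc _) 1≤d b wf e≥1 b⊥b N 1≤N x 0≤x≤1 = n , n<N , covering
  where
    scale : ∀ ℓ → Σ ℕ λ k → (p ^ (deg (b ℓ) * k)) ^ d ≤ N × N < (p ^ deg (b ℓ) * p ^ (deg (b ℓ) * k)) ^ d
    scale ℓ = p^e-scale (prime>1 pr) (e≥1 ℓ) 1≤d 1≤N
    Q : Fin d → ℕ
    Q ℓ = p ^ (deg (b ℓ) * proj₁ (scale ℓ))
    cell : ∀ ℓ → Σ ℕ λ c → c < Q ℓ × InCell c (Q ℓ) (x ℓ)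
    cell ℓ = cell-index (Q ℓ) (m^n>0 p (deg (b ℓ) * proj₁ (scale ℓ))) (proj₁ (0≤x≤1 ℓ)) (proj₂ (0≤x≤1 ℓ))
    box : Σ ℕ λ n → n < ∏ℕ Q × ∀ ℓ → InCell (proj₁ (cell ℓ)) (Q ℓ) (halton p b n ℓ)
    box = halton-hits-box p pr b wf e≥1 b⊥b (λ ℓ → proj₁ (scale ℓ)) (λ ℓ → proj₁ (cell ℓ)) (λ ℓ → proj₁ (proj₂ (cell ℓ)))
    n : ℕ
    n = proj₁ box
    n<N : n < N
    n<N = <-≤-trans (proj₁ (proj₂ box)) (∏ℕ-≤ 1≤d Q (λ ℓ → proj₁ (proj₂ (scale ℓ))))
    ℓ* : Fin d
    ℓ* = proj₁ (argmin Q)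
    M : ℕ
    M = maxFin d (λ ℓ → p ^ deg (b ℓ))
    N≤[M*Qℓ*]^d : N ≤ (M * Q ℓ*) ^ d
    N≤[M*Qℓ*]^d = ≤-trans (<⇒≤ (proj₂ (proj₂ (scale ℓ*)))) (^-monoˡ-≤ d (*-monoˡ-≤ (Q ℓ*) (≤-maxFin (λ ℓ → p ^ deg (b ℓ)) ℓ*)))
    close : ∀ ℓ → ℕtoℚ (Q ℓ* * Q ℓ*) ℚ.* powℚ (x ℓ ℚ.- halton p b n ℓ) 2 ℚ.≤ 1ℚ
    close ℓ = same-cell⇒close (proj₁ (cell ℓ)) (proj₂ (argmin Q) ℓ) (proj₂ (proj₂ (cell ℓ))) (proj₂ (proj₂ box) ℓ)
    covering : powℚ (dist² x (halton p b n)) d ℚ.* ℕtoℚ (N * N) ℚ.≤ ℕtoℚ (d ^ d * M ^ (2 * d))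
    covering = covering-inequality {dist² x (halton p b n)} {d} {Q ℓ*} {M} {N} (dist²-nonNeg x (halton p b n))
      (*-sumFin≤ d (λ ℓ → powℚ (x ℓ ℚ.- halton p b n ℓ) 2) (ℕtoℚ-nonNeg (Q ℓ* * Q ℓ*)) close) N≤[M*Qℓ*]^d
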